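{- Let $G$ be a finite graph without loops, parallel edges and isolated vertices, and let $G_1,\dots,G_k$ be its connected components. Let $N,N_1,\dots,N_k$ be numerations of the edges of $G,G_1,\dots,G_k$ respectively. Then $\chi_{MA(G,N)}(t)=\chi_{MA(G_1,N_1)}(t)\cdot\chi_{MA(G_2,N_2)}(t)\cdots\chi_{MA(G_k,N_k)}(t)$.
   Context: For a graph $H$ with $m$ edges, a numeration is a bijection $N:E(H)\to\{1,\dots,m\}$. Let $F$ be the set of all sequences of edges $(r_1,\dots,r_k)$ ($k\ge1$) forming a simple path in $H$, or a simple cycle of $H$ with an even number of edges. Each such sequence gives the hyperplane $x_{N(r_1)}-x_{N(r_2)}+\dots+(-1)^{k+1}x_{N(r_k)}=0$ in $\mathbb{R}^m$; the matching arrangement $MA(H,N)$ is the set of all these hyperplanes. For a hyperplane arrangement $A$ in $\mathbb{R}^m$, $L(A)$ is the poset of all nonempty intersections of subsets of hyperplanes of $A$ (including $\mathbb{R}^m$), ordered by reverse inclusion, with minimum $\hat0=\mathbb{R}^m$; $\mu(x)=\mu(\hat0,x)$ is its Möbius function, and $\chi_A(t)=\sum_{x\in L(A)}\mu(x)t^{\dim x}$.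
   Formalization: The matching arrangements, their intersection posets L(A) and the dimensions of the intersections are taken in ℚ^m instead of ℝ^m. -}

module Defs where

open import Level using (0ℓ)
open import Data.Nat as ℕ using (ℕ; zero; suc; _≤_)
open import Data.Nat.Base using (NonZero)
open import Data.Fin as Fin using (Fin; zero; suc; toℕ; inject₁; fromℕ)
open import Data.Fin.Properties using () renaming (_≟_ to _≟ᶠ_)
open import Data.Bool using (Bool; true; false; if_then_else_; T)
open import Data.Integer as ℤ using (ℤ)
open import Data.Rational as ℚ using (ℚ; 0ℚ; 1ℚ)
open import Data.Product using (Σ; ∃; ∃-syntax; _×_; _,_)
open import Data.Sum using (_⊎_)
open import Relation.Nullary using (¬_; does)
open import Relation.Unary using (Pred; _⊆_; _≐_)
open import Relation.Binary.PropositionalEquality using (_≡_)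
open import Function.Bundles using (_⤖_; _⇔_; Bijection)
open import Function.Definitions using (Injective)

∑ℚ : ∀ {k} → (Fin k → ℚ) → ℚ
∑ℚ {zero}  f = 0ℚ
∑ℚ {suc k} f = f zero ℚ.+ ∑ℚ (λ i → f (suc i))

∑ℤ : ∀ {k} → (Fin k → ℤ) → ℤ
∑ℤ {zero}  f = ℤ.0ℤ
∑ℤ {suc k} f = f zero ℤ.+ ∑ℤ (λ i → f (suc i))

∏ℤ : ∀ {k} → (Fin k → ℤ) → ℤ
∏ℤ {zero}  f = ℤ.1ℤ
∏ℤ {suc k} f = f zero ℤ.* ∏ℤ (λ i → f (suc i))

Vecℚ : ℕ → Set
Vecℚ m = Fin m → ℚ

dot : ∀ {m} → Vecℚ m → Vecℚ m → ℚ
dot a x = ∑ℚ (λ c → a c ℚ.* x c)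

lincomb : ∀ {m d} → (Fin d → ℚ) → (Fin d → Vecℚ m) → Vecℚ m
lincomb c b coord = ∑ℚ (λ j → c j ℚ.* b j coord)

HasDim : ∀ {m} → Pred (Vecℚ m) 0ℓ → ℕ → Set
HasDim {m} P d =
  Σ (Fin d → Vecℚ m) λ b →
    (∀ j → P (b j))
  × (∀ (c : Fin d → ℚ) → (∀ coord → lincomb c b coord ≡ 0ℚ) → ∀ j → c j ≡ 0ℚ)
  × (∀ x → P x → Σ (Fin d → ℚ) λ c → ∀ coord → x coord ≡ lincomb c b coord)

Sol : ∀ {I : Set} {m} → (I → Vecℚ m) → Pred I 0ℓ → Pred (Vecℚ m) 0ℓ
Sol a S x = ∀ i → S i → dot (a i) x ≡ 0ℚ

-- Data describing the intersection poset L(A) (an explicit enumeration of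
-- its elements, each listed exactly once), the dimension of each element,
-- the strict order of L(A) (reverse inclusion) as a Boolean table, and
-- the Möbius function μ(x) = μ(0̂, x) via its defining recursion.
record ChiWitness {I : Set} {m : ℕ} (a : I → Vecℚ m) : Set₁ where
  field
    size     : ℕ
    elt      : Fin size → Pred (Vecℚ m) 0ℓ
    elt-int  : ∀ x → Σ (Pred I 0ℓ) λ S → elt x ≐ Sol a S
    elt-all  : ∀ (S : Pred I 0ℓ) → Σ (Fin size) λ x → elt x ≐ Sol a S
    elt-uniq : ∀ x y → elt x ≐ elt y → x ≡ y
    dim      : Fin size → ℕ
    dim-ok   : ∀ x → HasDim (elt x) (dim x)
    lt       : Fin size → Fin size → Bool
    lt-ok    : ∀ y x → T (lt y x) ⇔ (elt x ⊆ elt y × ¬ (elt y ⊆ elt x))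
    μ        : Fin size → ℤ
    μ-bot    : ∀ x → (∀ v → elt x v) → μ x ≡ ℤ.1ℤ
    μ-rec    : ∀ x → ¬ (∀ v → elt x v) →
               μ x ≡ ℤ.- ∑ℤ (λ y → if lt y x then μ y else ℤ.0ℤ)

chi : ∀ {I : Set} {m} {a : I → Vecℚ m} → ChiWitness a → ℤ → ℤ
chi W t = ∑ℤ (λ x → μ x ℤ.* (t ℤ.^ dim x))
  where open ChiWitness W

record Graph : Set where
  field
    nV  : ℕ
    nE  : ℕ
    src : Fin nE → Fin nV
    tgt : Fin nE → Fin nV
open Graph public

Joins : (H : Graph) → Fin (nE H) → Fin (nV H) → Fin (nV H) → Set
Joins H e u w = (src H e ≡ u × tgt H e ≡ w) ⊎ (src H e ≡ w × tgt H e ≡ u)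

NoLoops : Graph → Set
NoLoops H = ∀ e → ¬ (src H e ≡ tgt H e)

NoParallelEdges : Graph → Set
NoParallelEdges H = ∀ e e' → Joins H e' (src H e) (tgt H e) → e ≡ e'

NoIsolatedVertices : Graph → Set
NoIsolatedVertices H = ∀ v → Σ (Fin (nE H)) λ e → (src H e ≡ v) ⊎ (tgt H e ≡ v)

data Reach (H : Graph) (u : Fin (nV H)) : Fin (nV H) → Set where
  here : Reach H u u
  step : ∀ {w w'} e → Reach H u w → Joins H e w w' → Reach H u w'

Connected : Graph → Set
Connected H = NonZero (nV H) × (∀ u w → Reach H u w)

-- The graphs Gs i (i < k) are (isomorphic copies, via vmap/emap, of) the
-- connected components of G: each is connected, the maps are compatible
-- with incidence, and the images partition V(G) and E(G).
record Components (G : Graph) (k : ℕ) (Gs : Fin k → Graph) : Set where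
  field
    connected : ∀ i → Connected (Gs i)
    vmap      : ∀ i → Fin (nV (Gs i)) → Fin (nV G)
    emap      : ∀ i → Fin (nE (Gs i)) → Fin (nE G)
    incidence : ∀ i e → Joins G (emap i e) (vmap i (src (Gs i) e)) (vmap i (tgt (Gs i) e))
    v-cover   : ∀ v → Σ (Fin k) λ i → Σ (Fin (nV (Gs i))) λ u → vmap i u ≡ v
    v-disj    : ∀ i u j u' → vmap i u ≡ vmap j u' →
                _≡_ {A = Σ (Fin k) λ i → Fin (nV (Gs i))} (i , u) (j , u')
    e-cover   : ∀ e → Σ (Fin k) λ i → Σ (Fin (nE (Gs i))) λ f → emap i f ≡ e
    e-disj    : ∀ i f j f' → emap i f ≡ emap j f' →
                _≡_ {A = Σ (Fin k) λ i → Fin (nE (Gs i))} (i , f) (j , f')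

Numeration : Graph → Set
Numeration H = Fin (nE H) ⤖ Fin (nE H)

record SimplePath (H : Graph) : Set where
  field
    len      : ℕ
    len≥1    : 1 ≤ len
    edge     : Fin len → Fin (nE H)
    vert     : Fin (suc len) → Fin (nV H)
    edge-inj : Injective _≡_ _≡_ edge
    vert-inj : Injective _≡_ _≡_ vert
    joins    : ∀ i → Joins H (edge i) (vert (inject₁ i)) (vert (suc i))

record EvenSimpleCycle (H : Graph) : Set where
  field
    len      : ℕ
    len≥1    : 1 ≤ len
    even     : Σ ℕ λ j → len ≡ 2 ℕ.* j
    edge     : Fin len → Fin (nE H)
    vert     : Fin (suc len) → Fin (nV H)
    edge-inj : Injective _≡_ _≡_ edge
    vert-inj : Injective _≡_ _≡_ (λ i → vert (inject₁ i))
    closed   : vert (fromℕ len) ≡ vert zero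
    joins    : ∀ i → Joins H (edge i) (vert (inject₁ i)) (vert (suc i))

MAIndex : Graph → Set
MAIndex H = SimplePath H ⊎ EvenSimpleCycle H

sign : ℕ → ℚ
sign zero    = 1ℚ
sign (suc i) = ℚ.- sign i

-- normal vector of x_{N(r_1)} - x_{N(r_2)} + … ± x_{N(r_k)}
altNormal : ∀ {m len} → (Fin m ⤖ Fin m) → (Fin len → Fin m) → Vecℚ m
altNormal N r c =
  ∑ℚ (λ i → if does (Bijection.to N (r i) ≟ᶠ c) then sign (toℕ i) else 0ℚ)

MA : (H : Graph) → Numeration H → MAIndex H → Vecℚ (nE H)
MA H N (Data.Sum.inj₁ p) = altNormal N (SimplePath.edge p)
MA H N (Data.Sum.inj₂ c) = altNormal N (EvenSimpleCycle.edge c)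

{-# OPTIONS --safe #-}

-- Every simple path and every even simple cycle of G lies inside one connected component, so
-- after renumbering the coordinates MA(G,N) is the product arrangement MA(G₁,N₁) × ⋯ × MA(G_k,N_k)
-- of the component arrangements, each living on its own block of coordinates.  The intersection
-- poset of a product arrangement is the product of the intersection posets: dimensions add and
-- the Möbius function multiplies, because Σ_{y ≤ x} μ(y) = [x = 0̂] is multiplicative.  Hence χ
-- is multiplicative.  A permutation of coordinates that matches the hyperplanes of two
-- arrangements induces an isomorphism of their intersection posets preserving μ and dimension,
-- so χ does not depend on the numerations; dimensions are compared through the uniqueness of
-- the dimension of a subspace (a homogeneous system with more unknowns than equations has a
-- nonzero solution).

module Submission where

open import Level using (0ℓ)
open import Algebra.Bundles using (CommutativeRing)
import Algebra.Properties.Semiring.Sum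
open import Axiom.UniquenessOfIdentityProofs using (module Decidable⇒UIP)
open import Data.Bool using (Bool; true; false; T; if_then_else_; _∧_; _∨_; not)
import Data.Bool.Properties as Boolₚ
open import Data.Empty using (⊥; ⊥-elim)
open import Data.Fin as Fin using (Fin; zero; suc; _↑ˡ_; _↑ʳ_; combine; remQuot; punchIn; inject₁)
open import Data.Fin.Induction using (spo-wellFounded)
open import Data.Fin.Permutation as Perm using (Permutation; _⟨$⟩ʳ_; _⟨$⟩ˡ_)
import Data.Fin.Properties as Finₚ
open import Data.Integer as ℤ using (ℤ)
import Data.Integer.Properties as ℤₚ
import Data.Integer.Solver as ℤ-Solver
open import Data.Nat as ℕ using (ℕ; zero; suc)
import Data.Nat.Properties as ℕₚ
open import Data.Product as Product using (Σ; ∃-syntax; _×_; _,_; proj₁; proj₂)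
open import Data.Product.Function.Dependent.Propositional using (Σ-↔)
open import Data.Product.Function.NonDependent.Propositional using (_×-⇔_)
open import Data.Product.Properties using (,-injectiveˡ; ,-injectiveʳ-UIP)
open import Data.Rational as ℚ using (ℚ; 0ℚ; 1ℚ)
import Data.Rational.Properties as ℚₚ
import Data.Rational.Solver as ℚ-Solver
open import Data.Sum as Sum using (_⊎_; inj₁; inj₂; [_,_]′)
open import Data.Unit using (⊤)
open import Data.Vec.Functional using (insertAt; _++_; take; drop)
open import Data.Vec.Functional.Properties using (insertAt-lookup; insertAt-punchIn; lookup-++ˡ; lookup-++ʳ)
open import Function using (_∘_; id; _$_)
open import Function.Bundles using (_⇔_; mk⇔; Equivalence; _↔_; mk↔ₛ′; Inverse; _⤖_; Bijection)
open import Function.Definitions using (Injective)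
import Function.Properties.Equivalence as ⇔
open import Function.Properties.Bijection using (⤖⇒↔)
open import Function.Properties.Inverse using (↔-refl; ↔-sym; ↔-trans)
open import Function.Related.TypeIsomorphisms using (¬-cong-⇔)
open import Induction.WellFounded using (WellFounded; Acc; acc)
open import Relation.Binary using (Rel; Irreflexive; Transitive; IsStrictPartialOrder)
open import Relation.Binary.PropositionalEquality
open import Relation.Nullary using (¬_; yes; no; does)
open import Relation.Nullary.Decidable using (dec-true; dec-false; T?; does-⇔)
open import Relation.Unary using (Pred; _⊆_; _≐_)

open import Defs

-- ∑ℚ and ∑ℤ of Defs unfold like the library's sum; the parameters ∑-zero and ∑-suc let its
-- lemmas be transported to them.
module FinSum (R : CommutativeRing 0ℓ 0ℓ) where

  open CommutativeRing R using (Carrier; _≈_; _+_; _*_; -_; 0#)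

  module Properties
    (≈⇒≡ : ∀ {x y} → x ≈ y → x ≡ y)
    (∑ : ∀ {k} → (Fin k → Carrier) → Carrier)
    (∑-zero : (f : Fin 0 → Carrier) → ∑ f ≡ 0#)
    (∑-suc : ∀ {k} (f : Fin (suc k) → Carrier) → ∑ f ≡ f zero + ∑ (f ∘ suc))
    where

    open CommutativeRing R using (semiring; +-identityˡ; +-assoc; +-abelianGroup)
    private module ∑ₛ = Algebra.Properties.Semiring.Sum semiring
    open import Algebra.Properties.AbelianGroup +-abelianGroup using (ε⁻¹≈ε; ⁻¹-∙-comm)
    open ≡-Reasoning

    ∑≡sum : ∀ {k} (f : Fin k → Carrier) → ∑ f ≡ ∑ₛ.sum f
    ∑≡sum {zero}  f = ∑-zero f
    ∑≡sum {suc k} f = trans (∑-suc f) (cong (f zero +_) (∑≡sum (f ∘ suc)))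

    ∑-cong : ∀ {k} {f g : Fin k → Carrier} → (∀ i → f i ≡ g i) → ∑ f ≡ ∑ g
    ∑-cong {f = f} {g} f≗g = trans (∑≡sum f) (trans (∑ₛ.sum-cong-≗ f≗g) (sym (∑≡sum g)))

    ∑-0 : ∀ k → ∑ {k} (λ _ → 0#) ≡ 0#
    ∑-0 k = trans (∑≡sum _) (≈⇒≡ (∑ₛ.sum-replicate-zero k))

    ∑-distrib-+ : ∀ {k} (f g : Fin k → Carrier) → ∑ (λ i → f i + g i) ≡ ∑ f + ∑ g
    ∑-distrib-+ f g = trans (∑≡sum _) (trans (≈⇒≡ (∑ₛ.∑-distrib-+ f g)) (sym (cong₂ _+_ (∑≡sum f) (∑≡sum g))))

    -‿∑ : ∀ {k} (f : Fin k → Carrier) → - ∑ f ≡ ∑ (-_ ∘ f)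
    -‿∑ {zero}  f = trans (cong -_ (∑-zero f)) (trans (≈⇒≡ ε⁻¹≈ε) (sym (∑-zero _)))
    -‿∑ {suc k} f = begin
      - ∑ f                          ≡⟨ cong -_ (∑-suc f) ⟩
      - (f zero + ∑ (f ∘ suc))       ≡⟨ ≈⇒≡ (CommutativeRing.sym R (⁻¹-∙-comm _ _)) ⟩
      - f zero + - ∑ (f ∘ suc)       ≡⟨ cong (- f zero +_) (-‿∑ (f ∘ suc)) ⟩
      - f zero + ∑ (-_ ∘ f ∘ suc)    ≡⟨ ∑-suc _ ⟨
      ∑ (-_ ∘ f)                     ∎

    *-distribˡ-∑ : ∀ {k} c (f : Fin k → Carrier) → c * ∑ f ≡ ∑ (λ i → c * f i)
    *-distribˡ-∑ c f = trans (cong (c *_) (∑≡sum f)) (trans (≈⇒≡ (∑ₛ.*-distribˡ-sum c f)) (sym (∑≡sum _)))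

    *-distribʳ-∑ : ∀ {k} c (f : Fin k → Carrier) → ∑ f * c ≡ ∑ (λ i → f i * c)
    *-distribʳ-∑ c f = trans (cong (_* c) (∑≡sum f)) (trans (≈⇒≡ (∑ₛ.*-distribʳ-sum c f)) (sym (∑≡sum _)))

    ∑*∑ : ∀ {m n} (f : Fin m → Carrier) (g : Fin n → Carrier) → ∑ f * ∑ g ≡ ∑ (λ i → ∑ (λ j → f i * g j))
    ∑*∑ f g = trans (*-distribʳ-∑ (∑ g) f) (∑-cong (λ i → *-distribˡ-∑ (f i) g))

    ∑-comm : ∀ {m n} (f : Fin m → Fin n → Carrier) → ∑ (λ i → ∑ (f i)) ≡ ∑ (λ j → ∑ (λ i → f i j))
    ∑-comm f = begin
      ∑ (λ i → ∑ (f i))                  ≡⟨ ∑-cong (λ i → ∑≡sum (f i)) ⟩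
      ∑ (λ i → ∑ₛ.sum (f i))              ≡⟨ ∑≡sum _ ⟩
      ∑ₛ.sum (λ i → ∑ₛ.sum (f i))          ≡⟨ ≈⇒≡ (∑ₛ.∑-comm f) ⟩
      ∑ₛ.sum (λ j → ∑ₛ.sum (λ i → f i j))  ≡⟨ ∑≡sum _ ⟨
      ∑ (λ j → ∑ₛ.sum (λ i → f i j))      ≡⟨ ∑-cong (λ j → ∑≡sum _) ⟨
      ∑ (λ j → ∑ (λ i → f i j))          ∎

    ∑-permute : ∀ {m n} (f : Fin n → Carrier) (π : Permutation m n) → ∑ f ≡ ∑ (f ∘ (π ⟨$⟩ʳ_))
    ∑-permute f π = trans (∑≡sum f) (trans (≈⇒≡ (∑ₛ.sum-permute f π)) (sym (∑≡sum _)))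

    ∑-remove : ∀ {n} (i : Fin (suc n)) (f : Fin (suc n) → Carrier) → ∑ f ≡ f i + ∑ (f ∘ punchIn i)
    ∑-remove i f = trans (∑≡sum f) (trans (≈⇒≡ (∑ₛ.sum-remove f)) (cong (f i +_) (sym (∑≡sum _))))

    ∑-↑ : ∀ {m n} (f : Fin (m ℕ.+ n) → Carrier) → ∑ f ≡ ∑ (f ∘ (_↑ˡ n)) + ∑ (f ∘ (m ↑ʳ_))
    ∑-↑ {zero}  f = sym (trans (cong (_+ ∑ f) (∑-zero _)) (≈⇒≡ (+-identityˡ _)))
    ∑-↑ {suc m} {n} f = begin
      ∑ f                                           ≡⟨ ∑-suc f ⟩
      f zero + ∑ (f ∘ suc)                          ≡⟨ cong (f zero +_) (∑-↑ (f ∘ suc)) ⟩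
      f zero + (∑ (f ∘ suc ∘ (_↑ˡ n)) + ∑ (f ∘ suc ∘ (m ↑ʳ_)))
                                                    ≡⟨ ≈⇒≡ (+-assoc _ _ _) ⟨
      (f zero + ∑ (f ∘ suc ∘ (_↑ˡ n))) + ∑ (f ∘ (suc m ↑ʳ_))
                                                    ≡⟨ cong (_+ ∑ (f ∘ (suc m ↑ʳ_))) (∑-suc _) ⟨
      ∑ (f ∘ (_↑ˡ n)) + ∑ (f ∘ (suc m ↑ʳ_))         ∎

    ∑-combine : ∀ {m n} (f : Fin (m ℕ.* n) → Carrier) → ∑ f ≡ ∑ (λ i → ∑ (λ j → f (combine {m} {n} i j)))
    ∑-combine {zero}  f = trans (∑-zero f) (sym (∑-zero _))
    ∑-combine {suc m} {n} f = begin
      ∑ f                                                      ≡⟨ ∑-↑ {n} f ⟩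
      ∑ (f ∘ (_↑ˡ m ℕ.* n)) + ∑ (f ∘ (n ↑ʳ_))                  ≡⟨ cong (∑ (f ∘ (_↑ˡ m ℕ.* n)) +_) (∑-combine (f ∘ (n ↑ʳ_))) ⟩
      ∑ (f ∘ (_↑ˡ m ℕ.* n)) + ∑ (λ i → ∑ (f ∘ (n ↑ʳ_) ∘ combine i))
                                                               ≡⟨ ∑-suc _ ⟨
      ∑ (λ i → ∑ (λ j → f (combine {suc m} {n} i j)))         ∎

    ∑-remQuot : ∀ {m n} (f : Fin m × Fin n → Carrier) → ∑ (f ∘ remQuot {m} n) ≡ ∑ (λ i → ∑ (λ j → f (i , j)))
    ∑-remQuot {m} {n} f =
      trans (∑-combine (f ∘ remQuot n)) (∑-cong (λ i → ∑-cong (λ j → cong f (Finₚ.remQuot-combine i j))))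

module ∑ℚₚ = FinSum.Properties ℚₚ.+-*-commutativeRing (λ x≡y → x≡y) ∑ℚ (λ _ → refl) (λ _ → refl)
module ∑ℤₚ = FinSum.Properties ℤₚ.+-*-commutativeRing (λ x≡y → x≡y) ∑ℤ (λ _ → refl) (λ _ → refl)

module Vectors where

  open import Data.Rational using (_+_; _*_)
  open ∑ℚₚ

  0ᵛ : ∀ {m} → Vecℚ m
  0ᵛ _ = 0ℚ

  dot-congˡ : ∀ {m} {a b : Vecℚ m} v → a ≗ b → dot a v ≡ dot b v
  dot-congˡ v a≗b = ∑-cong (λ c → cong (_* v c) (a≗b c))

  dot-congʳ : ∀ {m} a {v w : Vecℚ m} → v ≗ w → dot a v ≡ dot a w
  dot-congʳ a v≗w = ∑-cong (λ c → cong (a c *_) (v≗w c))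

  dot-zeroˡ : ∀ {m} (v : Vecℚ m) → dot 0ᵛ v ≡ 0ℚ
  dot-zeroˡ {m} v = trans (∑-cong (λ c → ℚₚ.*-zeroˡ (v c))) (∑-0 m)

  dot-zeroʳ : ∀ {m} (a : Vecℚ m) → dot a 0ᵛ ≡ 0ℚ
  dot-zeroʳ {m} a = trans (∑-cong (λ c → ℚₚ.*-zeroʳ (a c))) (∑-0 m)

  dot-permute : ∀ {m n} (a v : Vecℚ n) (π : Permutation m n) →
                dot (a ∘ (π ⟨$⟩ʳ_)) (v ∘ (π ⟨$⟩ʳ_)) ≡ dot a v
  dot-permute a v π = sym (∑-permute (λ c → a c * v c) π)

  dot-++ : ∀ {m n} (u : Vecℚ m) (w : Vecℚ n) v → dot (u ++ w) v ≡ dot u (take m v) + dot w (drop m v)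
  dot-++ {m} {n} u w v = trans (∑-↑ {m} {n} (λ c → (u ++ w) c * v c))
    (cong₂ _+_ (dot-congˡ (take m v) (lookup-++ˡ u w)) (dot-congˡ (drop m v) (lookup-++ʳ u w)))

  dot-++0ᵛ : ∀ {m n} (u : Vecℚ m) v → dot (u ++ 0ᵛ {n}) v ≡ dot u (take m v)
  dot-++0ᵛ {m} u v =
    trans (dot-++ u 0ᵛ v) (trans (cong (dot u (take m v) +_) (dot-zeroˡ (drop m v))) (ℚₚ.+-identityʳ _))

  dot-0ᵛ++ : ∀ {m n} (w : Vecℚ n) v → dot (0ᵛ {m} ++ w) v ≡ dot w (drop m v)
  dot-0ᵛ++ {m} w v =
    trans (dot-++ 0ᵛ w v) (trans (cong (_+ dot w (drop m v)) (dot-zeroˡ (take m v))) (ℚₚ.+-identityˡ _))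

  ↑-cases : ∀ {m n} (P : Fin (m ℕ.+ n) → Set) → (∀ i → P (i ↑ˡ n)) → (∀ i → P (m ↑ʳ i)) → ∀ j → P j
  ↑-cases {m} P Pˡ Pʳ j with Fin.splitAt m j in eq
  ... | inj₁ i = subst P (Finₚ.splitAt⁻¹-↑ˡ eq) (Pˡ i)
  ... | inj₂ i = subst P (Finₚ.splitAt⁻¹-↑ʳ eq) (Pʳ i)

  lincomb-congˡ : ∀ {m d} {c c′ : Fin d → ℚ} (b : Fin d → Vecℚ m) coord →
                  c ≗ c′ → lincomb c b coord ≡ lincomb c′ b coord
  lincomb-congˡ b coord c≗c′ = ∑-cong (λ j → cong (_* b j coord) (c≗c′ j))

  lincomb-0ᵛ : ∀ {m d} (c : Fin d → ℚ) (coord : Fin m) → lincomb c (λ _ → 0ᵛ) coord ≡ 0ℚ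
  lincomb-0ᵛ {d = d} c coord = trans (∑-cong (λ j → ℚₚ.*-zeroʳ (c j))) (∑-0 d)

  lincomb-++ : ∀ {m d₁ d₂} (c : Fin (d₁ ℕ.+ d₂) → ℚ) (u : Fin d₁ → Vecℚ m) (w : Fin d₂ → Vecℚ m) coord →
               lincomb c (u ++ w) coord ≡ lincomb (take d₁ c) u coord + lincomb (drop d₁ c) w coord
  lincomb-++ {d₁ = d₁} {d₂} c u w coord = trans (∑-↑ {d₁} {d₂} (λ j → c j * (u ++ w) j coord))
    (cong₂ _+_ (∑-cong (λ j → cong (λ b → c (j ↑ˡ d₂) * b coord) (lookup-++ˡ u w j)))
               (∑-cong (λ j → cong (λ b → c (d₁ ↑ʳ j) * b coord) (lookup-++ʳ u w j))))

open Vectors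

module Dimension where

  open import Data.Rational using (_+_; _*_; -_; _-_; 1/_)
  open ∑ℚₚ
  open ≡-Reasoning

  Nontrivial : ∀ {d} → (Fin d → ℚ) → Set
  Nontrivial c = ∃[ j ] c j ≢ 0ℚ

  Solves : ∀ {d e} → (Fin d → Fin e → ℚ) → (Fin d → ℚ) → Set
  Solves C c = ∀ l → ∑ℚ (λ j → c j * C j l) ≡ 0ℚ

  -- Gaussian elimination of the unknown j₀ with equation zero, where its coefficient p is nonzero:
  -- a solution c of the reduced system extends by c j₀ = - X / p to a solution of the full one.
  module Pivot {d e} (C : Fin (suc d) → Fin (suc e) → ℚ) (j₀ : Fin (suc d)) (p≢0 : C j₀ zero ≢ 0ℚ) where

    p : ℚ
    p = C j₀ zero

    instance
      p-nonZero : ℚ.NonZero p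
      p-nonZero = ℚ.≢-nonZero p≢0

    reduced : Fin d → Fin e → ℚ
    reduced j l = C (punchIn j₀ j) (suc l) - C (punchIn j₀ j) zero * 1/ p * C j₀ (suc l)

    module _ (c : Fin d → ℚ) where

      X : ℚ
      X = ∑ℚ (λ j → c j * C (punchIn j₀ j) zero)

      α : ℚ
      α = - (X * 1/ p)

      extended : Fin (suc d) → ℚ
      extended = insertAt c j₀ α

      extended-nontrivial : Nontrivial c → Nontrivial extended
      extended-nontrivial (j , cj≢0) = punchIn j₀ j , λ e → cj≢0 (trans (sym (insertAt-punchIn c j₀ _ j)) e)

      ∑-extended : ∀ l → ∑ℚ (λ j → extended j * C j l) ≡ α * C j₀ l + ∑ℚ (λ j → c j * C (punchIn j₀ j) l)
      ∑-extended l = trans (∑-remove j₀ (λ j → extended j * C j l))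
        (cong₂ _+_ (cong (_* C j₀ l) (insertAt-lookup c j₀ α))
                   (∑-cong (λ j → cong (_* C (punchIn j₀ j) l) (insertAt-punchIn c j₀ α j))))

      ∑-reduced : ∀ l → ∑ℚ (λ j → c j * reduced j l)
                        ≡ ∑ℚ (λ j → c j * C (punchIn j₀ j) (suc l)) - X * (1/ p * C j₀ (suc l))
      ∑-reduced l = begin
        ∑ℚ (λ j → c j * reduced j l)
          ≡⟨ ∑-cong (λ j → solve 5 (λ c a b q k → c :* (a :- b :* q :* k) := c :* a :- c :* b :* (q :* k))
                                 refl (c j) (a j) (b j) (1/ p) K) ⟩
        ∑ℚ (λ j → c j * a j - c j * b j * (1/ p * K))
          ≡⟨ ∑-distrib-+ (λ j → c j * a j) (λ j → - (c j * b j * (1/ p * K))) ⟩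
        Y + ∑ℚ (λ j → - (c j * b j * (1/ p * K)))
          ≡⟨ cong (Y +_) (-‿∑ (λ j → c j * b j * (1/ p * K))) ⟨
        Y - ∑ℚ (λ j → c j * b j * (1/ p * K))
          ≡⟨ cong (λ z → Y - z) (*-distribʳ-∑ (1/ p * K) (λ j → c j * b j)) ⟨
        Y - X * (1/ p * K) ∎
        where
        open ℚ-Solver.+-*-Solver
        a b : Fin d → ℚ
        a j = C (punchIn j₀ j) (suc l)
        b j = C (punchIn j₀ j) zero
        K = C j₀ (suc l)
        Y = ∑ℚ (λ j → c j * a j)

      extended-solves : Solves reduced c → Solves C extended
      extended-solves sol zero = begin
        ∑ℚ (λ j → extended j * C j zero)  ≡⟨ ∑-extended zero ⟩
        α * p + X                         ≡⟨ solve 3 (λ x q p → :- (x :* q) :* p :+ x := x :- x :* (q :* p))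
                                                   refl X (1/ p) p ⟩
        X - X * (1/ p * p)                ≡⟨ cong (λ z → X - X * z) (ℚₚ.*-inverseˡ p) ⟩
        X - X * 1ℚ                        ≡⟨ cong (λ z → X - z) (ℚₚ.*-identityʳ X) ⟩
        X - X                             ≡⟨ ℚₚ.+-inverseʳ X ⟩
        0ℚ                                ∎
        where open ℚ-Solver.+-*-Solver
      extended-solves sol (suc l) = begin
        ∑ℚ (λ j → extended j * C j (suc l))  ≡⟨ ∑-extended (suc l) ⟩
        α * K + Y                            ≡⟨ solve 4 (λ x q k y → :- (x :* q) :* k :+ y := y :- x :* (q :* k))
                                                      refl X (1/ p) K Y ⟩
        Y - X * (1/ p * K)                   ≡⟨ ∑-reduced l ⟨
        ∑ℚ (λ j → c j * reduced j l)         ≡⟨ sol l ⟩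
        0ℚ                                   ∎
        where
        open ℚ-Solver.+-*-Solver
        K = C j₀ (suc l)
        Y = ∑ℚ (λ j → c j * C (punchIn j₀ j) (suc l))

  homogeneous-nontrivial : ∀ {d e} → e ℕ.< d → (C : Fin d → Fin e → ℚ) → ∃[ c ] Nontrivial c × Solves C c
  homogeneous-nontrivial {suc d} {zero} _ C = (λ _ → 1ℚ) , (zero , λ ()) , λ ()
  homogeneous-nontrivial {suc d} {suc e} (ℕ.s≤s e<d) C with Finₚ.all? (λ j → C j zero ℚₚ.≟ 0ℚ)
  ... | yes column₀≡0 =
    let c , nt , sol = homogeneous-nontrivial (ℕₚ.m<n⇒m<1+n e<d) (λ j l → C j (suc l)) in
    c , nt , λ where
      zero    → trans (∑-cong (λ j → trans (cong (c j *_) (column₀≡0 j)) (ℚₚ.*-zeroʳ (c j)))) (∑-0 (suc d))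
      (suc l) → sol l
  ... | no column₀≢0 =
    let j₀ , p≢0 = Finₚ.¬∀⟶∃¬ (suc d) _ (λ j → C j zero ℚₚ.≟ 0ℚ) column₀≢0
        open Pivot C j₀ p≢0
        c , nt , sol = homogeneous-nontrivial e<d reduced in
    extended c , extended-nontrivial c nt , extended-solves c sol

  Independent : ∀ {m d} → (Fin d → Vecℚ m) → Set
  Independent b = ∀ c → (∀ coord → lincomb c b coord ≡ 0ℚ) → ∀ j → c j ≡ 0ℚ

  InSpan : ∀ {m e} → (Fin e → Vecℚ m) → Vecℚ m → Set
  InSpan b′ v = ∃[ C ] ∀ coord → v coord ≡ lincomb C b′ coord

  independent≤spanning : ∀ {m d e} (b : Fin d → Vecℚ m) (b′ : Fin e → Vecℚ m) →
                         Independent b → (∀ j → InSpan b′ (b j)) → d ℕ.≤ e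
  independent≤spanning {m} {d} {e} b b′ indep span with d ℕₚ.≤? e
  ... | yes d≤e = d≤e
  ... | no d≰e = ⊥-elim (c≢0 (indep c lincomb≡0 j))
    where
    C : Fin d → Fin e → ℚ
    C j = proj₁ (span j)
    solution = homogeneous-nontrivial (ℕₚ.≰⇒> d≰e) C
    c = proj₁ solution
    j = proj₁ (proj₁ (proj₂ solution))
    c≢0 = proj₂ (proj₁ (proj₂ solution))
    lincomb≡0 : ∀ coord → lincomb c b coord ≡ 0ℚ
    lincomb≡0 coord = begin
      ∑ℚ (λ j → c j * b j coord)
        ≡⟨ ∑-cong (λ j → cong (c j *_) (proj₂ (span j) coord)) ⟩
      ∑ℚ (λ j → c j * ∑ℚ (λ l → C j l * b′ l coord))
        ≡⟨ ∑-cong (λ j → *-distribˡ-∑ (c j) (λ l → C j l * b′ l coord)) ⟩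
      ∑ℚ (λ j → ∑ℚ (λ l → c j * (C j l * b′ l coord)))
        ≡⟨ ∑-comm (λ j l → c j * (C j l * b′ l coord)) ⟩
      ∑ℚ (λ l → ∑ℚ (λ j → c j * (C j l * b′ l coord)))
        ≡⟨ ∑-cong (λ l → ∑-cong (λ j → ℚₚ.*-assoc (c j) (C j l) (b′ l coord))) ⟨
      ∑ℚ (λ l → ∑ℚ (λ j → c j * C j l * b′ l coord))
        ≡⟨ ∑-cong (λ l → *-distribʳ-∑ (b′ l coord) (λ j → c j * C j l)) ⟨
      ∑ℚ (λ l → ∑ℚ (λ j → c j * C j l) * b′ l coord)
        ≡⟨ ∑-cong (λ l → trans (cong (_* b′ l coord) (proj₂ (proj₂ solution) l)) (ℚₚ.*-zeroˡ (b′ l coord))) ⟩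
      ∑ℚ {e} (λ _ → 0ℚ)
        ≡⟨ ∑-0 e ⟩
      0ℚ ∎

  HasDim-unique : ∀ {m} {P : Vecℚ m → Set} {d e} → HasDim P d → HasDim P e → d ≡ e
  HasDim-unique (b , b∈P , b-indep , b-span) (b′ , b′∈P , b′-indep , b′-span) =
    ℕₚ.≤-antisym (independent≤spanning b b′ b-indep (λ j → b′-span (b j) (b∈P j)))
                 (independent≤spanning b′ b b′-indep (λ j → b-span (b′ j) (b′∈P j)))

  _⊠_ : ∀ {m₁ m₂} → Pred (Vecℚ m₁) 0ℓ → Pred (Vecℚ m₂) 0ℓ → Pred (Vecℚ (m₁ ℕ.+ m₂)) 0ℓ
  _⊠_ {m₁} P₁ P₂ v = P₁ (take m₁ v) × P₂ (drop m₁ v)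

  Respects≗ : ∀ {m} → Pred (Vecℚ m) 0ℓ → Set
  Respects≗ P = ∀ {v w} → v ≗ w → P v → P w

  module _ {m₁ m₂ d₁ d₂} (b₁ : Fin d₁ → Vecℚ m₁) (b₂ : Fin d₂ → Vecℚ m₂) where

    juxtaposed : Fin (d₁ ℕ.+ d₂) → Vecℚ (m₁ ℕ.+ m₂)
    juxtaposed = (λ j → b₁ j ++ 0ᵛ) ++ (λ j → 0ᵛ ++ b₂ j)

    take-lincomb : ∀ c i → lincomb c juxtaposed (i ↑ˡ m₂) ≡ lincomb (take d₁ c) b₁ i
    take-lincomb c i = begin
      lincomb c juxtaposed (i ↑ˡ m₂)
        ≡⟨ lincomb-++ c (λ j → b₁ j ++ 0ᵛ) (λ j → 0ᵛ ++ b₂ j) (i ↑ˡ m₂) ⟩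
      lincomb (take d₁ c) (λ j → b₁ j ++ 0ᵛ) (i ↑ˡ m₂) + lincomb (drop d₁ c) (λ j → 0ᵛ ++ b₂ j) (i ↑ˡ m₂)
        ≡⟨ cong₂ _+_ (∑-cong (λ j → cong (take d₁ c j *_) (lookup-++ˡ (b₁ j) 0ᵛ i)))
                     (∑-cong (λ j → cong (drop d₁ c j *_) (lookup-++ˡ 0ᵛ (b₂ j) i))) ⟩
      lincomb (take d₁ c) b₁ i + lincomb (drop d₁ c) (λ _ → 0ᵛ) i
        ≡⟨ cong (lincomb (take d₁ c) b₁ i +_) (lincomb-0ᵛ (drop d₁ c) i) ⟩
      lincomb (take d₁ c) b₁ i + 0ℚ
        ≡⟨ ℚₚ.+-identityʳ _ ⟩
      lincomb (take d₁ c) b₁ i ∎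

    drop-lincomb : ∀ c i → lincomb c juxtaposed (m₁ ↑ʳ i) ≡ lincomb (drop d₁ c) b₂ i
    drop-lincomb c i = begin
      lincomb c juxtaposed (m₁ ↑ʳ i)
        ≡⟨ lincomb-++ c (λ j → b₁ j ++ 0ᵛ) (λ j → 0ᵛ ++ b₂ j) (m₁ ↑ʳ i) ⟩
      lincomb (take d₁ c) (λ j → b₁ j ++ 0ᵛ) (m₁ ↑ʳ i) + lincomb (drop d₁ c) (λ j → 0ᵛ ++ b₂ j) (m₁ ↑ʳ i)
        ≡⟨ cong₂ _+_ (∑-cong (λ j → cong (take d₁ c j *_) (lookup-++ʳ (b₁ j) 0ᵛ i)))
                     (∑-cong (λ j → cong (drop d₁ c j *_) (lookup-++ʳ (0ᵛ {m₁}) (b₂ j) i))) ⟩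
      lincomb (take d₁ c) (λ _ → 0ᵛ) i + lincomb (drop d₁ c) b₂ i
        ≡⟨ cong (_+ lincomb (drop d₁ c) b₂ i) (lincomb-0ᵛ (take d₁ c) i) ⟩
      0ℚ + lincomb (drop d₁ c) b₂ i
        ≡⟨ ℚₚ.+-identityˡ _ ⟩
      lincomb (drop d₁ c) b₂ i ∎

  HasDim-⊠ : ∀ {m₁ m₂ d₁ d₂} {P₁ : Pred (Vecℚ m₁) 0ℓ} {P₂ : Pred (Vecℚ m₂) 0ℓ} →
             Respects≗ P₁ → P₁ 0ᵛ → Respects≗ P₂ → P₂ 0ᵛ →
             HasDim P₁ d₁ → HasDim P₂ d₂ → HasDim (P₁ ⊠ P₂) (d₁ ℕ.+ d₂)
  HasDim-⊠ {m₁} {m₂} {d₁} {d₂} {P₁} {P₂} resp₁ 0∈P₁ resp₂ 0∈P₂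
           (b₁ , b₁∈P₁ , indep₁ , span₁) (b₂ , b₂∈P₂ , indep₂ , span₂) = b , b∈P , indep , span
    where
    b = juxtaposed b₁ b₂
    b∈P : ∀ j → (P₁ ⊠ P₂) (b j)
    b∈P = ↑-cases _
      (λ j → subst (P₁ ⊠ P₂) (sym (lookup-++ˡ left right j))
               (resp₁ (sym ∘ lookup-++ˡ (b₁ j) 0ᵛ) (b₁∈P₁ j) ,
                resp₂ (sym ∘ lookup-++ʳ (b₁ j) (0ᵛ {m₂})) 0∈P₂))
      (λ j → subst (P₁ ⊠ P₂) (sym (lookup-++ʳ left right j))
               (resp₁ (sym ∘ lookup-++ˡ (0ᵛ {m₁}) (b₂ j)) 0∈P₁ ,
                resp₂ (sym ∘ lookup-++ʳ (0ᵛ {m₁}) (b₂ j)) (b₂∈P₂ j)))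
      where
      left : Fin d₁ → Vecℚ (m₁ ℕ.+ m₂)
      left j = b₁ j ++ 0ᵛ
      right : Fin d₂ → Vecℚ (m₁ ℕ.+ m₂)
      right j = 0ᵛ ++ b₂ j
    indep : Independent b
    indep c lincomb≡0 = ↑-cases _
      (indep₁ (take d₁ c) (λ i → trans (sym (take-lincomb b₁ b₂ c i)) (lincomb≡0 (i ↑ˡ m₂))))
      (indep₂ (drop d₁ c) (λ i → trans (sym (drop-lincomb b₁ b₂ c i)) (lincomb≡0 (m₁ ↑ʳ i))))
    span : ∀ v → (P₁ ⊠ P₂) v → ∃[ c ] (∀ coord → v coord ≡ lincomb c b coord)
    span v (v₁∈P₁ , v₂∈P₂) =
      let c₁ , v₁≡ = span₁ _ v₁∈P₁
          c₂ , v₂≡ = span₂ _ v₂∈P₂ in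
      c₁ ++ c₂ , ↑-cases _
        (λ i → trans (v₁≡ i) (trans (lincomb-congˡ b₁ i (sym ∘ lookup-++ˡ c₁ c₂))
                                    (sym (take-lincomb b₁ b₂ (c₁ ++ c₂) i))))
        (λ i → trans (v₂≡ i) (trans (lincomb-congˡ b₂ i (sym ∘ lookup-++ʳ c₁ c₂))
                                    (sym (drop-lincomb b₁ b₂ (c₁ ++ c₂) i))))

  HasDim-≐ : ∀ {m d} {P Q : Pred (Vecℚ m) 0ℓ} → P ≐ Q → HasDim P d → HasDim Q d
  HasDim-≐ (P⊆Q , Q⊆P) (b , b∈P , indep , span) = b , P⊆Q ∘ b∈P , indep , λ v v∈Q → span v (Q⊆P v∈Q)

  HasDim-permute : ∀ {m m′ d} {P : Pred (Vecℚ m) 0ℓ} (π : Permutation m m′) → Respects≗ P →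
                   HasDim P d → HasDim (λ v′ → P (v′ ∘ (π ⟨$⟩ʳ_))) d
  HasDim-permute π resp (b , b∈P , indep , span) =
    (λ j → b j ∘ (π ⟨$⟩ˡ_)) ,
    (λ j → resp (λ _ → cong (b j) (sym (Perm.inverseˡ π))) (b∈P j)) ,
    (λ c lincomb≡0 → indep c (λ coord →
      trans (cong (lincomb c b) (sym (Perm.inverseˡ π))) (lincomb≡0 (π ⟨$⟩ʳ coord)))) ,
    (λ v′ v′∈P → let c , v′≡ = span _ v′∈P in
                 c , λ coord′ → trans (cong v′ (sym (Perm.inverseʳ π))) (v′≡ (π ⟨$⟩ˡ coord′)))

open Dimension using (HasDim-unique; HasDim-≐; HasDim-permute; HasDim-⊠; _⊠_; Respects≗)

module IndicatorSums where

  open import Data.Integer using (_+_; _*_; 0ℤ)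
  open ∑ℤₚ
  open ≡-Reasoning

  ∑-if-split : ∀ {n} (P : Fin n → Bool) (f : Fin n → ℤ) x → P x ≡ true →
               ∑ℤ (λ y → if P y then f y else 0ℤ)
               ≡ ∑ℤ (λ y → if P y ∧ not (does (y Finₚ.≟ x)) then f y else 0ℤ) + f x
  ∑-if-split {suc n} P f x Px = begin
    ∑ℤ h                              ≡⟨ ∑-remove x h ⟩
    h x + ∑ℤ (h ∘ punchIn x)          ≡⟨ cong₂ _+_ hx≡fx (∑-cong h≗g) ⟩
    f x + ∑ℤ (g ∘ punchIn x)          ≡⟨ ℤₚ.+-comm (f x) _ ⟩
    ∑ℤ (g ∘ punchIn x) + f x          ≡⟨ cong (_+ f x) (ℤₚ.+-identityˡ (∑ℤ (g ∘ punchIn x))) ⟨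
    (0ℤ + ∑ℤ (g ∘ punchIn x)) + f x   ≡⟨ cong (λ z → (z + ∑ℤ (g ∘ punchIn x)) + f x) gx≡0 ⟨
    (g x + ∑ℤ (g ∘ punchIn x)) + f x  ≡⟨ cong (_+ f x) (∑-remove x g) ⟨
    ∑ℤ g + f x                        ∎
    where
    h g : Fin (suc n) → ℤ
    h y = if P y then f y else 0ℤ
    g y = if P y ∧ not (does (y Finₚ.≟ x)) then f y else 0ℤ
    hx≡fx : h x ≡ f x
    hx≡fx rewrite Px = refl
    gx≡0 : g x ≡ 0ℤ
    gx≡0 rewrite dec-true (x Finₚ.≟ x) refl | Boolₚ.∧-zeroʳ (P x) = refl
    h≗g : ∀ j → h (punchIn x j) ≡ g (punchIn x j)
    h≗g j rewrite dec-false (punchIn x j Finₚ.≟ x) (Finₚ.punchInᵢ≢i x j)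
                | Boolₚ.∧-identityʳ (P (punchIn x j)) = refl

  if-∧-* : ∀ b c (u w : ℤ) → (if b ∧ c then u * w else 0ℤ) ≡ (if b then u else 0ℤ) * (if c then w else 0ℤ)
  if-∧-* true  true  u w = refl
  if-∧-* true  false u w = sym (ℤₚ.*-zeroʳ u)
  if-∧-* false c     u w = refl

open IndicatorSums

module IntersectionPoset {I : Set} {m : ℕ} {a : I → Vecℚ m} (W : ChiWitness a) where

  open ChiWitness W
  open import Data.Integer using (_+_; 0ℤ)

  elt-resp-≗ : ∀ x {v w} → v ≗ w → elt x v → elt x w
  elt-resp-≗ x v≗w v∈x =
    let S , x⊆S , S⊆x = elt-int x in
    S⊆x (λ i i∈S → trans (sym (dot-congʳ (a i) v≗w)) (x⊆S v∈x i i∈S))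

  0ᵛ∈elt : ∀ x → elt x 0ᵛ
  0ᵛ∈elt x = let S , _ , S⊆x = elt-int x in S⊆x (λ i _ → dot-zeroʳ (a i))

  0̂ : Fin size
  0̂ = proj₁ (elt-all (λ _ → ⊥))

  0̂-full : ∀ v → elt 0̂ v
  0̂-full v = proj₂ (proj₂ (elt-all (λ _ → ⊥))) (λ _ ())

  ⊆-antisym : ∀ {x y} → elt x ⊆ elt y → elt y ⊆ elt x → x ≡ y
  ⊆-antisym x⊆y y⊆x = elt-uniq _ _ (x⊆y , y⊆x)

  full⇒0̂ : ∀ {x} → (∀ v → elt x v) → x ≡ 0̂
  full⇒0̂ full = ⊆-antisym (λ {v} _ → 0̂-full v) (λ {v} _ → full v)

  _<_ : Rel (Fin size) 0ℓ
  y < x = T (lt y x)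

  <⇒⊇ : ∀ {y x} → y < x → elt x ⊆ elt y
  <⇒⊇ {y} {x} y<x = proj₁ (Equivalence.to (lt-ok y x) y<x)

  <⇒⊉ : ∀ {y x} → y < x → ¬ (elt y ⊆ elt x)
  <⇒⊉ {y} {x} y<x = proj₂ (Equivalence.to (lt-ok y x) y<x)

  ⊇⇒< : ∀ {y x} → elt x ⊆ elt y → y ≢ x → y < x
  ⊇⇒< {y} {x} x⊆y y≢x = Equivalence.from (lt-ok y x) (x⊆y , λ y⊆x → y≢x (⊆-antisym y⊆x x⊆y))

  <-irrefl : Irreflexive _≡_ _<_
  <-irrefl refl x<x = <⇒⊉ x<x id

  <-trans : Transitive _<_
  <-trans z<y y<x = Equivalence.from (lt-ok _ _)
    (<⇒⊇ z<y ∘ <⇒⊇ y<x , λ z⊆x → <⇒⊉ z<y (<⇒⊇ y<x ∘ z⊆x))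

  <-isStrictPartialOrder : IsStrictPartialOrder _≡_ _<_
  <-isStrictPartialOrder = record
    { isEquivalence = isEquivalence ; irrefl = <-irrefl ; trans = <-trans ; <-resp-≈ = resp₂ _<_ }

  <-wellFounded : WellFounded _<_
  <-wellFounded = spo-wellFounded <-isStrictPartialOrder

  _≤ᵇ_ : Fin size → Fin size → Bool
  y ≤ᵇ x = lt y x ∨ does (y Finₚ.≟ x)

  ≤ᵇ-refl : ∀ x → x ≤ᵇ x ≡ true
  ≤ᵇ-refl x rewrite dec-true (x Finₚ.≟ x) refl = Boolₚ.∨-zeroʳ (lt x x)

  T-≤ᵇ : ∀ {y x} → T (y ≤ᵇ x) ⇔ elt x ⊆ elt y
  T-≤ᵇ {y} {x} = mk⇔ to from
    where
    to : T (y ≤ᵇ x) → elt x ⊆ elt y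
    to y≤x with y Finₚ.≟ x
    ... | yes refl = id
    ... | no _     = <⇒⊇ (subst T (Boolₚ.∨-identityʳ (lt y x)) y≤x)
    from : elt x ⊆ elt y → T (y ≤ᵇ x)
    from x⊆y with y Finₚ.≟ x
    ... | yes _   = Equivalence.from (Boolₚ.T-∨ {lt y x}) (inj₂ _)
    ... | no y≢x  = Equivalence.from (Boolₚ.T-∨ {lt y x}) (inj₁ (⊇⇒< x⊆y y≢x))

  lt≡≤ᵇ∧≢ : ∀ y x → lt y x ≡ (y ≤ᵇ x) ∧ not (does (y Finₚ.≟ x))
  lt≡≤ᵇ∧≢ y x with y Finₚ.≟ x
  ... | yes refl = trans (dec-false (T? (lt y y)) (<-irrefl refl)) (sym (Boolₚ.∧-zeroʳ _))
  ... | no _     = sym (trans (Boolₚ.∧-identityʳ _) (Boolₚ.∨-identityʳ _))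

  ∑μ≤ : Fin size → ℤ
  ∑μ≤ x = ∑ℤ (λ y → if y ≤ᵇ x then μ y else 0ℤ)

  ∑μ≤≡∑μ<+μ : ∀ x → ∑μ≤ x ≡ ∑ℤ (λ y → if lt y x then μ y else 0ℤ) + μ x
  ∑μ≤≡∑μ<+μ x = trans (∑-if-split (_≤ᵇ x) μ x (≤ᵇ-refl x))
    (cong (_+ μ x) (∑ℤₚ.∑-cong (λ y → cong (λ b → if b then μ y else 0ℤ) (sym (lt≡≤ᵇ∧≢ y x)))))

  ∑μ≤-≢0̂ : ∀ {x} → x ≢ 0̂ → ∑μ≤ x ≡ 0ℤ
  ∑μ≤-≢0̂ {x} x≢0̂ = trans (∑μ≤≡∑μ<+μ x)
    (trans (cong (∑μ< +_) (μ-rec x (x≢0̂ ∘ full⇒0̂))) (ℤₚ.+-inverseʳ ∑μ<))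
    where ∑μ< = ∑ℤ (λ y → if lt y x then μ y else 0ℤ)

_×ᴬ_ : ∀ {I₁ I₂ : Set} {m₁ m₂} → (I₁ → Vecℚ m₁) → (I₂ → Vecℚ m₂) → I₁ ⊎ I₂ → Vecℚ (m₁ ℕ.+ m₂)
(a₁ ×ᴬ a₂) (inj₁ i) = a₁ i ++ 0ᵛ
(a₁ ×ᴬ a₂) (inj₂ i) = 0ᵛ ++ a₂ i

Sol-×ᴬ : ∀ {I₁ I₂ : Set} {m₁ m₂} (a₁ : I₁ → Vecℚ m₁) (a₂ : I₂ → Vecℚ m₂) S →
         Sol (a₁ ×ᴬ a₂) S ≐ Sol a₁ (S ∘ inj₁) ⊠ Sol a₂ (S ∘ inj₂)
Sol-×ᴬ {m₁ = m₁} a₁ a₂ S = split , join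
  where
  split : Sol (a₁ ×ᴬ a₂) S ⊆ Sol a₁ (S ∘ inj₁) ⊠ Sol a₂ (S ∘ inj₂)
  split {v} sol = (λ i i∈S → trans (sym (dot-++0ᵛ (a₁ i) v)) (sol (inj₁ i) i∈S)) ,
                  (λ i i∈S → trans (sym (dot-0ᵛ++ {m₁} (a₂ i) v)) (sol (inj₂ i) i∈S))
  join : Sol a₁ (S ∘ inj₁) ⊠ Sol a₂ (S ∘ inj₂) ⊆ Sol (a₁ ×ᴬ a₂) S
  join {v} (sol₁ , sol₂) (inj₁ i) i∈S = trans (dot-++0ᵛ (a₁ i) v) (sol₁ i i∈S)
  join {v} (sol₁ , sol₂) (inj₂ i) i∈S = trans (dot-0ᵛ++ {m₁} (a₂ i) v) (sol₂ i i∈S)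

module ProductWitness {I₁ I₂ : Set} {m₁ m₂ : ℕ} {a₁ : I₁ → Vecℚ m₁} {a₂ : I₂ → Vecℚ m₂}
                      (W₁ : ChiWitness a₁) (W₂ : ChiWitness a₂) where

  open import Data.Integer using (_+_; _*_; _^_; -_; 0ℤ; 1ℤ)
  open ≡-Reasoning
  module A₁ = ChiWitness W₁
  module A₂ = ChiWitness W₂
  module P₁ = IntersectionPoset W₁
  module P₂ = IntersectionPoset W₂

  Pair : Set
  Pair = Fin A₁.size × Fin A₂.size

  size : ℕ
  size = A₁.size ℕ.* A₂.size

  pair : Fin size → Pair
  pair = remQuot A₂.size

  pair-injective : ∀ {x y} → pair x ≡ pair y → x ≡ y
  pair-injective {x} {y} eq = begin
    x                                 ≡⟨ Finₚ.combine-remQuot {A₁.size} A₂.size x ⟨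
    Product.uncurry combine (pair x)  ≡⟨ cong (Product.uncurry combine) eq ⟩
    Product.uncurry combine (pair y)  ≡⟨ Finₚ.combine-remQuot {A₁.size} A₂.size y ⟩
    y                                 ∎

  ⟦_⟧ : Pair → Pred (Vecℚ (m₁ ℕ.+ m₂)) 0ℓ
  ⟦ x₁ , x₂ ⟧ = A₁.elt x₁ ⊠ A₂.elt x₂

  ⟦⟧-⊆ : ∀ {x₁ x₂ y₁ y₂} → ⟦ x₁ , x₂ ⟧ ⊆ ⟦ y₁ , y₂ ⟧ ⇔ (A₁.elt x₁ ⊆ A₁.elt y₁ × A₂.elt x₂ ⊆ A₂.elt y₂)
  ⟦⟧-⊆ {x₁} {x₂} {y₁} {y₂} = mk⇔ to from
    where
    to : ⟦ x₁ , x₂ ⟧ ⊆ ⟦ y₁ , y₂ ⟧ → A₁.elt x₁ ⊆ A₁.elt y₁ × A₂.elt x₂ ⊆ A₂.elt y₂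
    to x⊆y =
      (λ {v} v∈x₁ → P₁.elt-resp-≗ y₁ (lookup-++ˡ v (0ᵛ {m₂})) (proj₁ (x⊆y {v ++ 0ᵛ} (embed₁ v∈x₁)))) ,
      (λ {v} v∈x₂ → P₂.elt-resp-≗ y₂ (lookup-++ʳ (0ᵛ {m₁}) v) (proj₂ (x⊆y {0ᵛ ++ v} (embed₂ v∈x₂))))
      where
      embed₁ : ∀ {v} → A₁.elt x₁ v → ⟦ x₁ , x₂ ⟧ (v ++ 0ᵛ)
      embed₁ {v} v∈x₁ = P₁.elt-resp-≗ x₁ (sym ∘ lookup-++ˡ v (0ᵛ {m₂})) v∈x₁ ,
                        P₂.elt-resp-≗ x₂ (sym ∘ lookup-++ʳ v (0ᵛ {m₂})) (P₂.0ᵛ∈elt x₂)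
      embed₂ : ∀ {v} → A₂.elt x₂ v → ⟦ x₁ , x₂ ⟧ (0ᵛ ++ v)
      embed₂ {v} v∈x₂ = P₁.elt-resp-≗ x₁ (sym ∘ lookup-++ˡ (0ᵛ {m₁}) v) (P₁.0ᵛ∈elt x₁) ,
                        P₂.elt-resp-≗ x₂ (sym ∘ lookup-++ʳ (0ᵛ {m₁}) v) v∈x₂
    from : A₁.elt x₁ ⊆ A₁.elt y₁ × A₂.elt x₂ ⊆ A₂.elt y₂ → ⟦ x₁ , x₂ ⟧ ⊆ ⟦ y₁ , y₂ ⟧
    from (x₁⊆y₁ , x₂⊆y₂) (v₁∈x₁ , v₂∈x₂) = x₁⊆y₁ v₁∈x₁ , x₂⊆y₂ v₂∈x₂

  elt : Fin size → Pred (Vecℚ (m₁ ℕ.+ m₂)) 0ℓ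
  elt x = ⟦ pair x ⟧

  elt-int : ∀ x → ∃[ S ] elt x ≐ Sol (a₁ ×ᴬ a₂) S
  elt-int x =
    let S₁ , x₁⊆S₁ , S₁⊆x₁ = A₁.elt-int (proj₁ (pair x))
        S₂ , x₂⊆S₂ , S₂⊆x₂ = A₂.elt-int (proj₂ (pair x))
        S = [ S₁ , S₂ ]′ in
    S , (λ {v} (v₁∈x₁ , v₂∈x₂) → proj₂ (Sol-×ᴬ a₁ a₂ S) {v} (x₁⊆S₁ v₁∈x₁ , x₂⊆S₂ v₂∈x₂)) ,
        (λ {v} sol → let sol₁ , sol₂ = proj₁ (Sol-×ᴬ a₁ a₂ S) {v} sol in S₁⊆x₁ sol₁ , S₂⊆x₂ sol₂)

  elt-all : ∀ S → ∃[ x ] elt x ≐ Sol (a₁ ×ᴬ a₂) S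
  elt-all S =
    let x₁ , x₁⊆S₁ , S₁⊆x₁ = A₁.elt-all (S ∘ inj₁)
        x₂ , x₂⊆S₂ , S₂⊆x₂ = A₂.elt-all (S ∘ inj₂)
        elt≡ = cong ⟦_⟧ (Finₚ.remQuot-combine x₁ x₂) in
    combine x₁ x₂ ,
    (λ {v} v∈x → let v₁∈x₁ , v₂∈x₂ = subst (_$ v) elt≡ v∈x in
                 proj₂ (Sol-×ᴬ a₁ a₂ S) {v} (x₁⊆S₁ v₁∈x₁ , x₂⊆S₂ v₂∈x₂)) ,
    (λ {v} sol → let sol₁ , sol₂ = proj₁ (Sol-×ᴬ a₁ a₂ S) {v} sol in
                 subst (_$ v) (sym elt≡) (S₁⊆x₁ sol₁ , S₂⊆x₂ sol₂))

  elt-uniq : ∀ x y → elt x ≐ elt y → x ≡ y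
  elt-uniq x y (x⊆y , y⊆x) =
    let x₁⊆y₁ , x₂⊆y₂ = Equivalence.to ⟦⟧-⊆ (λ {v} → x⊆y {v})
        y₁⊆x₁ , y₂⊆x₂ = Equivalence.to ⟦⟧-⊆ (λ {v} → y⊆x {v}) in
    pair-injective (cong₂ _,_ (P₁.⊆-antisym x₁⊆y₁ y₁⊆x₁) (P₂.⊆-antisym x₂⊆y₂ y₂⊆x₂))

  dim : Fin size → ℕ
  dim x = A₁.dim (proj₁ (pair x)) ℕ.+ A₂.dim (proj₂ (pair x))

  dim-ok : ∀ x → HasDim (elt x) (dim x)
  dim-ok x = HasDim-⊠ (P₁.elt-resp-≗ x₁) (P₁.0ᵛ∈elt x₁) (P₂.elt-resp-≗ x₂) (P₂.0ᵛ∈elt x₂)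
                      (A₁.dim-ok x₁) (A₂.dim-ok x₂)
    where
    x₁ = proj₁ (pair x)
    x₂ = proj₂ (pair x)

  _≤ᵇ_ : Fin size → Fin size → Bool
  y ≤ᵇ x = (proj₁ (pair y) P₁.≤ᵇ proj₁ (pair x)) ∧ (proj₂ (pair y) P₂.≤ᵇ proj₂ (pair x))

  ≤ᵇ-refl : ∀ x → x ≤ᵇ x ≡ true
  ≤ᵇ-refl x rewrite P₁.≤ᵇ-refl (proj₁ (pair x)) | P₂.≤ᵇ-refl (proj₂ (pair x)) = refl

  T-≤ᵇ : ∀ {y x} → T (y ≤ᵇ x) ⇔ elt x ⊆ elt y
  T-≤ᵇ = ⇔.trans Boolₚ.T-∧ (⇔.trans (P₁.T-≤ᵇ ×-⇔ P₂.T-≤ᵇ) (⇔.sym ⟦⟧-⊆))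

  lt : Fin size → Fin size → Bool
  lt y x = (y ≤ᵇ x) ∧ not (does (y Finₚ.≟ x))

  lt-ok : ∀ y x → T (lt y x) ⇔ (elt x ⊆ elt y × ¬ (elt y ⊆ elt x))
  lt-ok y x = mk⇔ to from
    where
    to : T (lt y x) → elt x ⊆ elt y × ¬ (elt y ⊆ elt x)
    to y<x =
      let y≤x , y≢x = Equivalence.to (Boolₚ.T-∧ {y ≤ᵇ x}) y<x
          x⊆y = Equivalence.to T-≤ᵇ y≤x in
      (λ {v} → x⊆y {v}) ,
      λ y⊆x → subst (T ∘ not) (dec-true (y Finₚ.≟ x) (elt-uniq y x ((λ {v} → y⊆x {v}) , (λ {v} → x⊆y {v}))))
                    y≢x
    from : elt x ⊆ elt y × ¬ (elt y ⊆ elt x) → T (lt y x)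
    from (x⊆y , y⊈x) = Equivalence.from (Boolₚ.T-∧ {y ≤ᵇ x})
      (Equivalence.from T-≤ᵇ (λ {v} → x⊆y {v}) ,
       Equivalence.from Boolₚ.T-not-≡ (dec-false (y Finₚ.≟ x) y≢x))
      where
      y≢x : y ≢ x
      y≢x refl = y⊈x id

  μ : Fin size → ℤ
  μ x = A₁.μ (proj₁ (pair x)) * A₂.μ (proj₂ (pair x))

  full-components : ∀ x → (∀ v → elt x v) →
                    (∀ v → A₁.elt (proj₁ (pair x)) v) × (∀ v → A₂.elt (proj₂ (pair x)) v)
  full-components x full =
    (λ v → P₁.elt-resp-≗ _ (lookup-++ˡ v (0ᵛ {m₂})) (proj₁ (full (v ++ 0ᵛ)))) ,
    (λ v → P₂.elt-resp-≗ _ (lookup-++ʳ (0ᵛ {m₁}) v) (proj₂ (full (0ᵛ ++ v))))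

  μ-bot : ∀ x → (∀ v → elt x v) → μ x ≡ 1ℤ
  μ-bot x full = let full₁ , full₂ = full-components x full in
    cong₂ _*_ (A₁.μ-bot _ full₁) (A₂.μ-bot _ full₂)

  ∑μ≤-× : ∀ x → ∑ℤ (λ y → if y ≤ᵇ x then μ y else 0ℤ) ≡ P₁.∑μ≤ (proj₁ (pair x)) * P₂.∑μ≤ (proj₂ (pair x))
  ∑μ≤-× x = begin
    ∑ℤ (f ∘ pair)                                      ≡⟨ ∑ℤₚ.∑-remQuot f ⟩
    ∑ℤ (λ y₁ → ∑ℤ (λ y₂ → f (y₁ , y₂)))                ≡⟨ ∑ℤₚ.∑-cong (λ y₁ → ∑ℤₚ.∑-cong (λ y₂ →
                                                            if-∧-* (y₁ P₁.≤ᵇ x₁) (y₂ P₂.≤ᵇ x₂) (A₁.μ y₁) (A₂.μ y₂))) ⟩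
    ∑ℤ (λ y₁ → ∑ℤ (λ y₂ → below₁ y₁ * below₂ y₂))      ≡⟨ ∑ℤₚ.∑*∑ below₁ below₂ ⟨
    P₁.∑μ≤ x₁ * P₂.∑μ≤ x₂                              ∎
    where
    x₁ = proj₁ (pair x)
    x₂ = proj₂ (pair x)
    f : Pair → ℤ
    f (y₁ , y₂) = if (y₁ P₁.≤ᵇ x₁) ∧ (y₂ P₂.≤ᵇ x₂) then A₁.μ y₁ * A₂.μ y₂ else 0ℤ
    below₁ : Fin A₁.size → ℤ
    below₁ y₁ = if y₁ P₁.≤ᵇ x₁ then A₁.μ y₁ else 0ℤ
    below₂ : Fin A₂.size → ℤ
    below₂ y₂ = if y₂ P₂.≤ᵇ x₂ then A₂.μ y₂ else 0ℤ

  ∑μ≤-≢full : ∀ x → ¬ (∀ v → elt x v) → ∑ℤ (λ y → if y ≤ᵇ x then μ y else 0ℤ) ≡ 0ℤ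
  ∑μ≤-≢full x not-full = trans (∑μ≤-× x) product≡0
    where
    x₁ = proj₁ (pair x)
    x₂ = proj₂ (pair x)
    product≡0 : P₁.∑μ≤ x₁ * P₂.∑μ≤ x₂ ≡ 0ℤ
    product≡0 with x₁ Finₚ.≟ P₁.0̂ | x₂ Finₚ.≟ P₂.0̂
    ... | no x₁≢0̂ | _ = trans (cong (_* P₂.∑μ≤ x₂) (P₁.∑μ≤-≢0̂ x₁≢0̂)) (ℤₚ.*-zeroˡ (P₂.∑μ≤ x₂))
    ... | yes _ | no x₂≢0̂ = trans (cong (P₁.∑μ≤ x₁ *_) (P₂.∑μ≤-≢0̂ x₂≢0̂)) (ℤₚ.*-zeroʳ (P₁.∑μ≤ x₁))
    ... | yes x₁≡0̂ | yes x₂≡0̂ = ⊥-elim (not-full (λ v →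
      subst (λ y₁ → A₁.elt y₁ _) (sym x₁≡0̂) (P₁.0̂-full _) ,
      subst (λ y₂ → A₂.elt y₂ _) (sym x₂≡0̂) (P₂.0̂-full _)))

  μ-rec : ∀ x → ¬ (∀ v → elt x v) → μ x ≡ - ∑ℤ (λ y → if lt y x then μ y else 0ℤ)
  μ-rec x not-full = inverseʳ-unique _ (μ x) (begin
    ∑ℤ (λ y → if lt y x then μ y else 0ℤ) + μ x  ≡⟨ ∑-if-split (_≤ᵇ x) μ x (≤ᵇ-refl x) ⟨
    ∑ℤ (λ y → if y ≤ᵇ x then μ y else 0ℤ)        ≡⟨ ∑μ≤-≢full x not-full ⟩
    0ℤ                                           ∎)
    where open import Algebra.Properties.AbelianGroup ℤₚ.+-0-abelianGroup using (inverseʳ-unique)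

  W : ChiWitness (a₁ ×ᴬ a₂)
  W = record
    { size = size ; elt = elt ; elt-int = elt-int ; elt-all = elt-all ; elt-uniq = elt-uniq
    ; dim = dim ; dim-ok = dim-ok ; lt = lt ; lt-ok = lt-ok ; μ = μ ; μ-bot = μ-bot ; μ-rec = μ-rec }

  chi-× : ∀ t → chi W t ≡ chi W₁ t * chi W₂ t
  chi-× t = begin
    ∑ℤ (g ∘ pair)                          ≡⟨ ∑ℤₚ.∑-remQuot g ⟩
    ∑ℤ (λ y₁ → ∑ℤ (λ y₂ → g (y₁ , y₂)))    ≡⟨ ∑ℤₚ.∑-cong (λ y₁ → ∑ℤₚ.∑-cong (λ y₂ → split y₁ y₂)) ⟩
    ∑ℤ (λ y₁ → ∑ℤ (λ y₂ → g₁ y₁ * g₂ y₂))  ≡⟨ ∑ℤₚ.∑*∑ g₁ g₂ ⟨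
    chi W₁ t * chi W₂ t                    ∎
    where
    g : Pair → ℤ
    g (y₁ , y₂) = A₁.μ y₁ * A₂.μ y₂ * t ^ (A₁.dim y₁ ℕ.+ A₂.dim y₂)
    g₁ : Fin A₁.size → ℤ
    g₁ y₁ = A₁.μ y₁ * t ^ A₁.dim y₁
    g₂ : Fin A₂.size → ℤ
    g₂ y₂ = A₂.μ y₂ * t ^ A₂.dim y₂
    split : ∀ y₁ y₂ → g (y₁ , y₂) ≡ g₁ y₁ * g₂ y₂
    split y₁ y₂ = trans (cong (A₁.μ y₁ * A₂.μ y₂ *_) (ℤₚ.^-distribˡ-+-* t (A₁.dim y₁) (A₂.dim y₂)))
      (solve 4 (λ a b c d → (a :* b) :* (c :* d) := (a :* c) :* (b :* d))
              refl (A₁.μ y₁) (A₂.μ y₂) (t ^ A₁.dim y₁) (t ^ A₂.dim y₂))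
      where open ℤ-Solver.+-*-Solver

open ProductWitness using (chi-×) renaming (W to _×ᵂ_)

module IteratedProduct where

  ∑ℕ : ∀ {k} → (Fin k → ℕ) → ℕ
  ∑ℕ {zero}  ms = 0
  ∑ℕ {suc k} ms = ms zero ℕ.+ ∑ℕ (ms ∘ suc)

  ⨄ : ∀ {k} → (Fin k → Set) → Set
  ⨄ {zero}  Is = ⊥
  ⨄ {suc k} Is = Is zero ⊎ ⨄ (Is ∘ suc)

  ⨂ᴬ : ∀ {k} {ms : Fin k → ℕ} {Is : Fin k → Set} → ((i : Fin k) → Is i → Vecℚ (ms i)) → ⨄ Is → Vecℚ (∑ℕ ms)
  ⨂ᴬ {zero}  as = ⊥-elim
  ⨂ᴬ {suc k} as = as zero ×ᴬ ⨂ᴬ (as ∘ suc)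

  Fin1-unique : (x y : Fin 1) → x ≡ y
  Fin1-unique zero zero = refl

  emptyWitness : ChiWitness {⊥} {0} ⊥-elim
  emptyWitness = record
    { size = 1
    ; elt = λ _ _ → ⊤
    ; elt-int = λ _ → (λ _ → ⊥) , (λ _ ()) , _
    ; elt-all = λ _ → zero , (λ _ ()) , _
    ; elt-uniq = λ x y _ → Fin1-unique x y
    ; dim = λ _ → 0
    ; dim-ok = λ _ → (λ ()) , (λ ()) , (λ _ _ ()) , (λ _ _ → (λ ()) , λ ())
    ; lt = λ _ _ → false
    ; lt-ok = λ _ _ → mk⇔ (λ ()) (λ (_ , ⊉) → ⊉ _)
    ; μ = λ _ → ℤ.1ℤ
    ; μ-bot = λ _ _ → refl
    ; μ-rec = λ _ not-full → ⊥-elim (not-full _)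
    }

  ⨂ᵂ : ∀ {k} {ms : Fin k → ℕ} {Is : Fin k → Set} {as : (i : Fin k) → Is i → Vecℚ (ms i)} →
       ((i : Fin k) → ChiWitness (as i)) → ChiWitness (⨂ᴬ as)
  ⨂ᵂ {zero}  Ws = emptyWitness
  ⨂ᵂ {suc k} Ws = Ws zero ×ᵂ ⨂ᵂ (Ws ∘ suc)

  chi-⨂ : ∀ {k} {ms : Fin k → ℕ} {Is : Fin k → Set} {as : (i : Fin k) → Is i → Vecℚ (ms i)}
          (Ws : (i : Fin k) → ChiWitness (as i)) t → chi (⨂ᵂ Ws) t ≡ ∏ℤ (λ i → chi (Ws i) t)
  chi-⨂ {zero}  Ws t = refl
  chi-⨂ {suc k} Ws t = trans (chi-× (Ws zero) (⨂ᵂ (Ws ∘ suc)) t) (cong (chi (Ws zero) t ℤ.*_) (chi-⨂ (Ws ∘ suc) t))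

  inj : ∀ {k} {Is : Fin k → Set} (i : Fin k) → Is i → ⨄ Is
  inj zero    q = inj₁ q
  inj (suc i) q = inj₂ (inj i q)

  inj-surjective : ∀ {k} {Is : Fin k → Set} (p : ⨄ Is) → ∃[ i ] ∃[ q ] inj {Is = Is} i q ≡ p
  inj-surjective {suc k} (inj₁ q) = zero , q , refl
  inj-surjective {suc k} (inj₂ p) = let i , q , eq = inj-surjective p in suc i , q , cong inj₂ eq

  place : ∀ {k} {ms : Fin k → ℕ} (i : Fin k) → Fin (ms i) → Fin (∑ℕ ms)
  place {suc k} {ms} zero    c = c ↑ˡ ∑ℕ (ms ∘ suc)
  place {suc k} {ms} (suc i) c = ms zero ↑ʳ place i c

  unplace : ∀ {k} {ms : Fin k → ℕ} → Fin (∑ℕ ms) → Σ (Fin k) (Fin ∘ ms)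
  unplace {suc k} {ms} c with Fin.splitAt (ms zero) c
  ... | inj₁ c₀ = zero , c₀
  ... | inj₂ c′ = let i , c = unplace {ms = ms ∘ suc} c′ in suc i , c

  place-unplace : ∀ {k} {ms : Fin k → ℕ} c → Product.uncurry (place {ms = ms}) (unplace c) ≡ c
  place-unplace {suc k} {ms} c with Fin.splitAt (ms zero) c in eq
  ... | inj₁ c₀ = Finₚ.splitAt⁻¹-↑ˡ eq
  ... | inj₂ c′ = trans (cong (ms zero ↑ʳ_) (place-unplace {ms = ms ∘ suc} c′)) (Finₚ.splitAt⁻¹-↑ʳ eq)

  unplace-place : ∀ {k} {ms : Fin k → ℕ} i c → unplace {ms = ms} (place i c) ≡ (i , c)
  unplace-place {suc k} {ms} zero c rewrite Finₚ.splitAt-↑ˡ (ms zero) c (∑ℕ (ms ∘ suc)) = refl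
  unplace-place {suc k} {ms} (suc i) c rewrite Finₚ.splitAt-↑ʳ (ms zero) (∑ℕ (ms ∘ suc)) (place i c) =
    cong (λ (i , c) → suc i , c) (unplace-place {ms = ms ∘ suc} i c)

  placement : ∀ {k} {ms : Fin k → ℕ} → Σ (Fin k) (Fin ∘ ms) ↔ Fin (∑ℕ ms)
  placement {ms = ms} =
    mk↔ₛ′ (Product.uncurry place) unplace (place-unplace {ms = ms}) (Product.uncurry unplace-place)

  ⨂ᴬ-place : ∀ {k} {ms : Fin k → ℕ} {Is : Fin k → Set} (as : (i : Fin k) → Is i → Vecℚ (ms i)) i q c →
              ⨂ᴬ as (inj i q) (place i c) ≡ as i q c
  ⨂ᴬ-place as zero    q c = lookup-++ˡ (as zero q) 0ᵛ c
  ⨂ᴬ-place {ms = ms} as (suc i) q c =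
    trans (lookup-++ʳ (0ᵛ {ms zero}) (⨂ᴬ (as ∘ suc) (inj i q)) (place i c)) (⨂ᴬ-place (as ∘ suc) i q c)

  ⨂ᴬ-place-≢ : ∀ {k} {ms : Fin k → ℕ} {Is : Fin k → Set} (as : (i : Fin k) → Is i → Vecℚ (ms i)) {i j} → i ≢ j →
               ∀ q c → ⨂ᴬ as (inj i q) (place j c) ≡ 0ℚ
  ⨂ᴬ-place-≢ as {zero}  {zero}  0≢0 q c = ⊥-elim (0≢0 refl)
  ⨂ᴬ-place-≢ as {zero}  {suc j} _   q c = lookup-++ʳ (as zero q) 0ᵛ (place j c)
  ⨂ᴬ-place-≢ as {suc i} {zero}  _   q c = lookup-++ˡ 0ᵛ (⨂ᴬ (as ∘ suc) (inj i q)) c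
  ⨂ᴬ-place-≢ {ms = ms} as {suc i} {suc j} i≢j q c =
    trans (lookup-++ʳ (0ᵛ {ms zero}) (⨂ᴬ (as ∘ suc) (inj i q)) (place j c))
          (⨂ᴬ-place-≢ (as ∘ suc) (i≢j ∘ cong suc) q c)

open IteratedProduct

Matches : ∀ {I I′ : Set} {m m′} → (I → Vecℚ m) → (I′ → Vecℚ m′) → Permutation m m′ → I → I′ → Set
Matches a a′ π p p′ = ∀ c → a p c ≡ a′ p′ (π ⟨$⟩ʳ c)

Matches-flip : ∀ {I I′ : Set} {m m′} {a : I → Vecℚ m} {a′ : I′ → Vecℚ m′} (π : Permutation m m′) {p p′} →
               Matches a a′ π p p′ → Matches a′ a (Perm.flip π) p′ p
Matches-flip {a = a} {a′} π {p} {p′} matches c′ =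
  trans (cong (a′ p′) (sym (Perm.inverseʳ π))) (sym (matches (π ⟨$⟩ˡ c′)))

T-⇔⇒≡ : ∀ {b c} → T b ⇔ T c → b ≡ c
T-⇔⇒≡ T-b⇔T-c = Boolₚ.⇔→≡ (⇔.trans (⇔.sym Boolₚ.T-≡) (⇔.trans T-b⇔T-c Boolₚ.T-≡))

module Transport {I I′ : Set} {m m′} (a : I → Vecℚ m) (a′ : I′ → Vecℚ m′) (π : Permutation m m′)
                 (matching : ∀ p → ∃[ p′ ] Matches a a′ π p p′) (W : ChiWitness a) (W′ : ChiWitness a′) where

  module A = ChiWitness W
  module A′ = ChiWitness W′

  pull : Vecℚ m′ → Vecℚ m
  pull v′ = v′ ∘ (π ⟨$⟩ʳ_)

  image : Pred I 0ℓ → Pred I′ 0ℓ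
  image S p′ = ∃[ p ] S p × Matches a a′ π p p′

  dot-pull : ∀ {p p′} → Matches a a′ π p p′ → ∀ v′ → dot (a p) (pull v′) ≡ dot (a′ p′) v′
  dot-pull {p} {p′} matches v′ = trans (dot-congˡ (pull v′) matches) (dot-permute (a′ p′) v′ π)

  Sol-image : ∀ S v′ → Sol a′ (image S) v′ ⇔ Sol a S (pull v′)
  Sol-image S v′ = mk⇔
    (λ sol p p∈S → let p′ , matches = matching p in trans (dot-pull matches v′) (sol p′ (p , p∈S , matches)))
    (λ sol p′ (p , p∈S , matches) → trans (sym (dot-pull matches v′)) (sol p p∈S))

  φ : Fin A.size → Fin A′.size
  φ x = proj₁ (A′.elt-all (image (proj₁ (A.elt-int x))))

  φ-elt : ∀ x v′ → A′.elt (φ x) v′ ⇔ A.elt x (pull v′)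
  φ-elt x v′ =
    let S , x⊆S , S⊆x = A.elt-int x
        _ , φx⊆S′ , S′⊆φx = A′.elt-all (image S) in
    mk⇔ (λ v′∈φx → S⊆x (Equivalence.to (Sol-image S v′) (φx⊆S′ v′∈φx)))
        (λ pullv′∈x → S′⊆φx (Equivalence.from (Sol-image S v′) (x⊆S pullv′∈x)))

module PermutedArrangement {I I′ : Set} {m m′} (a : I → Vecℚ m) (a′ : I′ → Vecℚ m′) (π : Permutation m m′)
  (matching→ : ∀ p → ∃[ p′ ] Matches a a′ π p p′) (matching← : ∀ p′ → ∃[ p ] Matches a a′ π p p′)
  (W : ChiWitness a) (W′ : ChiWitness a′) where

  open import Data.Integer using (_*_; _^_; -_; 0ℤ)
  open ≡-Reasoning
  module A = ChiWitness W
  module A′ = ChiWitness W′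
  module P = IntersectionPoset W
  module P′ = IntersectionPoset W′

  flipped-matching : ∀ p′ → ∃[ p ] Matches a′ a (Perm.flip π) p′ p
  flipped-matching p′ = Product.map₂ (Matches-flip {a = a} {a′} π) (matching← p′)

  open Transport a a′ π matching→ W W′ using (φ; φ-elt; pull)
  open Transport a′ a (Perm.flip π) flipped-matching W′ W using () renaming (φ to ψ; φ-elt to ψ-elt; pull to push)
  open Equivalence using (to; from)

  pull-push : ∀ v → pull (push v) ≗ v
  pull-push v c = cong v (Perm.inverseˡ π)

  push-pull : ∀ v′ → push (pull v′) ≗ v′
  push-pull v′ c′ = cong v′ (Perm.inverseʳ π)

  φ-elt-push : ∀ x v → A′.elt (φ x) (push v) ⇔ A.elt x v
  φ-elt-push x v =
    ⇔.trans (φ-elt x (push v)) (mk⇔ (P.elt-resp-≗ x (pull-push v)) (P.elt-resp-≗ x (sym ∘ pull-push v)))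

  ψ∘φ : ∀ x → ψ (φ x) ≡ x
  ψ∘φ x = P.⊆-antisym (λ {v} → to (φ-elt-push x v) ∘ to (ψ-elt (φ x) v))
                      (λ {v} → from (ψ-elt (φ x) v) ∘ from (φ-elt-push x v))

  φ∘ψ : ∀ x′ → φ (ψ x′) ≡ x′
  φ∘ψ x′ = P′.⊆-antisym
    (λ {v′} v′∈φψx′ → P′.elt-resp-≗ x′ (push-pull v′) (to (ψ-elt x′ (pull v′)) (to (φ-elt (ψ x′) v′) v′∈φψx′)))
    (λ {v′} v′∈x′ → from (φ-elt (ψ x′) v′)
                         (from (ψ-elt x′ (pull v′)) (P′.elt-resp-≗ x′ (sym ∘ push-pull v′) v′∈x′)))

  Φ : Permutation A.size A′.size
  Φ = Perm.permutation φ ψ φ∘ψ ψ∘φ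

  φ-⊆ : ∀ {x y} → A.elt x ⊆ A.elt y ⇔ A′.elt (φ x) ⊆ A′.elt (φ y)
  φ-⊆ {x} {y} = mk⇔
    (λ x⊆y {v′} v′∈φx → from (φ-elt y v′) (x⊆y (to (φ-elt x v′) v′∈φx)))
    (λ φx⊆φy {v} v∈x → to (φ-elt-push y v) (φx⊆φy (from (φ-elt-push x v) v∈x)))

  φ-full : ∀ {x} → (∀ v → A.elt x v) → ∀ v′ → A′.elt (φ x) v′
  φ-full {x} full v′ = from (φ-elt x v′) (full (pull v′))

  φ-full⁻¹ : ∀ {x} → (∀ v′ → A′.elt (φ x) v′) → ∀ v → A.elt x v
  φ-full⁻¹ {x} full v = to (φ-elt-push x v) (full (push v))

  lt-φ : ∀ y x → A′.lt (φ y) (φ x) ≡ A.lt y x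
  lt-φ y x = T-⇔⇒≡ (⇔.trans (A′.lt-ok (φ y) (φ x))
                    (⇔.trans (⇔.sym φ-⊆ ×-⇔ ¬-cong-⇔ (⇔.sym φ-⊆)) (⇔.sym (A.lt-ok y x))))

  μ-φ : ∀ x → A.μ x ≡ A′.μ (φ x)
  μ-φ x = go x (P.<-wellFounded x)
    where
    go : ∀ x → Acc P._<_ x → A.μ x ≡ A′.μ (φ x)
    go x (acc rec) with x Finₚ.≟ P.0̂
    ... | yes refl = trans (A.μ-bot P.0̂ P.0̂-full) (sym (A′.μ-bot (φ P.0̂) (φ-full P.0̂-full)))
    ... | no x≢0̂ = begin
      A.μ x                                           ≡⟨ A.μ-rec x (x≢0̂ ∘ P.full⇒0̂) ⟩
      - ∑ℤ (λ y → if A.lt y x then A.μ y else 0ℤ)     ≡⟨ cong -_ (∑ℤₚ.∑-cong term) ⟩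
      - ∑ℤ (below′ ∘ φ)                               ≡⟨ cong -_ (∑ℤₚ.∑-permute below′ Φ) ⟨
      - ∑ℤ below′                                     ≡⟨ A′.μ-rec (φ x) (x≢0̂ ∘ P.full⇒0̂ ∘ φ-full⁻¹) ⟨
      A′.μ (φ x)                                      ∎
      where
      below′ : Fin A′.size → ℤ
      below′ y′ = if A′.lt y′ (φ x) then A′.μ y′ else 0ℤ
      term : ∀ y → (if A.lt y x then A.μ y else 0ℤ) ≡ below′ (φ y)
      term y rewrite lt-φ y x with A.lt y x in y<x
      ... | false = refl
      ... | true  = go y (rec (subst T (sym y<x) _))

  dim-φ : ∀ x → A.dim x ≡ A′.dim (φ x)
  dim-φ x = HasDim-unique
    (HasDim-≐ ((λ {v′} → from (φ-elt x v′)) , (λ {v′} → to (φ-elt x v′)))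
              (HasDim-permute π (P.elt-resp-≗ x) (A.dim-ok x)))
    (A′.dim-ok (φ x))

  chi-≡ : ∀ t → chi W t ≡ chi W′ t
  chi-≡ t = begin
    ∑ℤ (λ x → A.μ x * t ^ A.dim x)              ≡⟨ ∑ℤₚ.∑-cong (λ x → cong₂ (λ μ d → μ * t ^ d) (μ-φ x) (dim-φ x)) ⟩
    ∑ℤ (λ x → A′.μ (φ x) * t ^ A′.dim (φ x))    ≡⟨ ∑ℤₚ.∑-permute (λ x′ → A′.μ x′ * t ^ A′.dim x′) Φ ⟨
    ∑ℤ (λ x′ → A′.μ x′ * t ^ A′.dim x′)         ∎

Joins-sym : ∀ {H e u w} → Joins H e u w → Joins H e w u
Joins-sym = Sum.swap

Joins-ends : ∀ {H e u w u′ w′} → Joins H e u w → Joins H e u′ w′ → (u ≡ u′ × w ≡ w′) ⊎ (u ≡ w′ × w ≡ u′)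
Joins-ends (inj₁ (refl , refl)) (inj₁ (refl , refl)) = inj₁ (refl , refl)
Joins-ends (inj₁ (refl , refl)) (inj₂ (refl , refl)) = inj₂ (refl , refl)
Joins-ends (inj₂ (refl , refl)) (inj₁ (refl , refl)) = inj₂ (refl , refl)
Joins-ends (inj₂ (refl , refl)) (inj₂ (refl , refl)) = inj₁ (refl , refl)

chain-constant : ∀ {A : Set} {n} (f : Fin (suc n) → A) → (∀ l → f (inject₁ l) ≡ f (suc l)) → ∀ j → f j ≡ f zero
chain-constant f adjacent zero = refl
chain-constant {n = suc n} f adjacent (suc j) = trans (sym (adjacent j)) (chain-constant (f ∘ inject₁) (adjacent ∘ inject₁) j)

module ComponentDecomposition {G : Graph} {k : ℕ} {Gs : Fin k → Graph} (C : Components G k Gs) where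

  open Components C

  emap-injective : ∀ i {f f′} → emap i f ≡ emap i f′ → f ≡ f′
  emap-injective i = ,-injectiveʳ-UIP (Decidable⇒UIP.≡-irrelevant Finₚ._≟_) ∘ e-disj i _ i _

  vmap-injective : ∀ i {u u′} → vmap i u ≡ vmap i u′ → u ≡ u′
  vmap-injective i = ,-injectiveʳ-UIP (Decidable⇒UIP.≡-irrelevant Finₚ._≟_) ∘ v-disj i _ i _

  Joins-emap : ∀ i {f u w} → Joins (Gs i) f u w → Joins G (emap i f) (vmap i u) (vmap i w)
  Joins-emap i {f} (inj₁ (refl , refl)) = incidence i f
  Joins-emap i {f} (inj₂ (refl , refl)) = Joins-sym {G} (incidence i f)

  Joins-emap⁻¹ : ∀ i {f u w} → Joins G (emap i f) (vmap i u) (vmap i w) → Joins (Gs i) f u w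
  Joins-emap⁻¹ i {f} joins with Joins-ends {G} (incidence i f) joins
  ... | inj₁ (s≡u , t≡w) = inj₁ (vmap-injective i s≡u , vmap-injective i t≡w)
  ... | inj₂ (s≡w , t≡u) = inj₂ (vmap-injective i s≡w , vmap-injective i t≡u)

  component : Fin (nV G) → Fin k
  component v = proj₁ (v-cover v)

  edgeComponent : Fin (nE G) → Fin k
  edgeComponent e = proj₁ (e-cover e)

  component-vmap : ∀ i {u v} → vmap i u ≡ v → component v ≡ i
  component-vmap i {u} refl = ,-injectiveˡ (v-disj _ _ i u (proj₂ (proj₂ (v-cover (vmap i u)))))

  Joins-component : ∀ {e u w} → Joins G e u w → component u ≡ edgeComponent e × component w ≡ edgeComponent e
  Joins-component {e} joins with e-cover e
  ... | i , f , refl with Joins-ends {G} (incidence i f) joins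
  ...   | inj₁ (s≡u , t≡w) = component-vmap i s≡u , component-vmap i t≡w
  ...   | inj₂ (s≡w , t≡u) = component-vmap i t≡u , component-vmap i s≡w

  edge-in : ∀ e {i} → edgeComponent e ≡ i → ∃[ f ] emap i f ≡ e
  edge-in e refl = proj₂ (e-cover e)

  vertex-in : ∀ v {i} → component v ≡ i → ∃[ u ] vmap i u ≡ v
  vertex-in v refl = proj₂ (v-cover v)

  module LiftWalk {len} (edge : Fin len → Fin (nE G)) (vert : Fin (suc len) → Fin (nV G))
                  (joins : ∀ l → Joins G (edge l) (vert (inject₁ l)) (vert (suc l))) where

    i : Fin k
    i = component (vert zero)

    component-vert : ∀ j → component (vert j) ≡ i
    component-vert = chain-constant (component ∘ vert)
      (λ l → let u∈ , w∈ = Joins-component (joins l) in trans u∈ (sym w∈))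

    edgeComponent-edge : ∀ l → edgeComponent (edge l) ≡ i
    edgeComponent-edge l = trans (sym (proj₁ (Joins-component (joins l)))) (component-vert (inject₁ l))

    edge′ : Fin len → Fin (nE (Gs i))
    edge′ l = proj₁ (edge-in (edge l) (edgeComponent-edge l))

    emap-edge′ : ∀ l → emap i (edge′ l) ≡ edge l
    emap-edge′ l = proj₂ (edge-in (edge l) (edgeComponent-edge l))

    vert′ : Fin (suc len) → Fin (nV (Gs i))
    vert′ j = proj₁ (vertex-in (vert j) (component-vert j))

    vmap-vert′ : ∀ j → vmap i (vert′ j) ≡ vert j
    vmap-vert′ j = proj₂ (vertex-in (vert j) (component-vert j))

    joins′ : ∀ l → Joins (Gs i) (edge′ l) (vert′ (inject₁ l)) (vert′ (suc l))
    joins′ l = Joins-emap⁻¹ i joins-in-G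
      where
      joins-in-G : Joins G (emap i (edge′ l)) (vmap i (vert′ (inject₁ l))) (vmap i (vert′ (suc l)))
      joins-in-G rewrite emap-edge′ l | vmap-vert′ (inject₁ l) | vmap-vert′ (suc l) = joins l

    edge′-injective : Injective _≡_ _≡_ edge → Injective _≡_ _≡_ edge′
    edge′-injective edge-inj eq = edge-inj (trans (sym (emap-edge′ _)) (trans (cong (emap i) eq) (emap-edge′ _)))

    vert′-injective : ∀ {A : Set} (g : A → Fin (suc len)) →
                      Injective _≡_ _≡_ (vert ∘ g) → Injective _≡_ _≡_ (vert′ ∘ g)
    vert′-injective g vert-inj eq = vert-inj (trans (sym (vmap-vert′ _)) (trans (cong (vmap i) eq) (vmap-vert′ _)))

  module LiftPath (p : SimplePath G) where
    open SimplePath p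
    open LiftWalk edge vert joins public

    path′ : SimplePath (Gs i)
    path′ = record
      { len = len ; len≥1 = len≥1 ; edge = edge′ ; vert = vert′
      ; edge-inj = edge′-injective edge-inj ; vert-inj = vert′-injective id vert-inj ; joins = joins′ }

  module LiftCycle (c : EvenSimpleCycle G) where
    open EvenSimpleCycle c
    open LiftWalk edge vert joins public

    cycle′ : EvenSimpleCycle (Gs i)
    cycle′ = record
      { len = len ; len≥1 = len≥1 ; even = even ; edge = edge′ ; vert = vert′
      ; edge-inj = edge′-injective edge-inj ; vert-inj = vert′-injective inject₁ vert-inj
      ; closed = vmap-injective i (trans (vmap-vert′ _) (trans closed (sym (vmap-vert′ _))))
      ; joins = joins′ }

  pushPath : ∀ i → SimplePath (Gs i) → SimplePath G
  pushPath i p = record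
    { len = len ; len≥1 = len≥1 ; edge = emap i ∘ edge ; vert = vmap i ∘ vert
    ; edge-inj = edge-inj ∘ emap-injective i ; vert-inj = vert-inj ∘ vmap-injective i
    ; joins = Joins-emap i ∘ joins }
    where open SimplePath p

  pushCycle : ∀ i → EvenSimpleCycle (Gs i) → EvenSimpleCycle G
  pushCycle i c = record
    { len = len ; len≥1 = len≥1 ; even = even ; edge = emap i ∘ edge ; vert = vmap i ∘ vert
    ; edge-inj = edge-inj ∘ emap-injective i ; vert-inj = vert-inj ∘ vmap-injective i
    ; closed = cong (vmap i) closed ; joins = Joins-emap i ∘ joins }
    where open EvenSimpleCycle c

to≡⇔≡from : ∀ {A B : Set} (π : A ↔ B) {x y} → (Inverse.to π x ≡ y) ⇔ (x ≡ Inverse.from π y)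
to≡⇔≡from π {x} {y} = mk⇔ (λ eq → trans (sym (Inverse.strictlyInverseʳ π x)) (cong (Inverse.from π) eq))
                          (λ eq → trans (cong (Inverse.to π) eq) (Inverse.strictlyInverseˡ π y))

altNormal-cong : ∀ {m m′ len} (N : Fin m ⤖ Fin m) (N′ : Fin m′ ⤖ Fin m′)
                 (r : Fin len → Fin m) (r′ : Fin len → Fin m′) {c c′} →
                 (∀ l → (Bijection.to N (r l) ≡ c) ⇔ (Bijection.to N′ (r′ l) ≡ c′)) →
                 altNormal N r c ≡ altNormal N′ r′ c′
altNormal-cong N N′ r r′ {c} {c′} hits = ∑ℚₚ.∑-cong (λ l → cong (λ b → if b then sign (Fin.toℕ l) else 0ℚ)
  (does-⇔ (hits l) (Bijection.to N (r l) Finₚ.≟ c) (Bijection.to N′ (r′ l) Finₚ.≟ c′)))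

altNormal-zero : ∀ {m len} (N : Fin m ⤖ Fin m) (r : Fin len → Fin m) {c} →
                 (∀ l → Bijection.to N (r l) ≢ c) → altNormal N r c ≡ 0ℚ
altNormal-zero {len = len} N r misses =
  trans (∑ℚₚ.∑-cong (λ l → cong (λ b → if b then sign (Fin.toℕ l) else 0ℚ) (dec-false (_ Finₚ.≟ _) (misses l))))
        (∑ℚₚ.∑-0 len)

module ComponentArrangements {G : Graph} {k : ℕ} {Gs : Fin k → Graph} (C : Components G k Gs)
                             (N : Numeration G) (Ns : (i : Fin k) → Numeration (Gs i)) where

  open Components C
  open ComponentDecomposition C

  Ms : Fin k → ℕ
  Ms i = nE (Gs i)

  as : (i : Fin k) → MAIndex (Gs i) → Vecℚ (Ms i)
  as i = MA (Gs i) (Ns i)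

  componentEdges : Σ (Fin k) (Fin ∘ Ms) ↔ Fin (nE G)
  componentEdges = mk↔ₛ′ (Product.uncurry emap) (λ e → let i , f , _ = e-cover e in i , f)
    (λ e → proj₂ (proj₂ (e-cover e))) (λ (i , f) → e-disj _ _ i f (proj₂ (proj₂ (e-cover (emap i f)))))

  -- Π ⟨$⟩ʳ c computes to place i (Ns i f), where (i , f , _) = e-cover (N⁻¹ c): the coordinate of
  -- an edge of G moves into the block of its component, at the slot given by that component's numeration.
  Π : Permutation (nE G) (∑ℕ Ms)
  Π = ↔-trans (↔-sym (⤖⇒↔ N)) (↔-trans (↔-sym componentEdges) (↔-trans (Σ-↔ ↔-refl (⤖⇒↔ (Ns _))) placement))

  along : ∀ i (x : MAIndex (Gs i)) {len} (r : Fin len → Fin (nE G)) (r′ : Fin len → Fin (Ms i)) →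
          (∀ l → emap i (r′ l) ≡ r l) → as i x ≗ altNormal (Ns i) r′ →
          ∀ c → altNormal N r c ≡ ⨂ᴬ as (inj i x) (Π ⟨$⟩ʳ c)
  along i x r r′ r≡ x≗ c with e-cover (Inverse.from (⤖⇒↔ N) c)
  ... | j , f , emap-f≡ with i Finₚ.≟ j
  ...   | yes refl = begin
    altNormal N r c                                    ≡⟨ altNormal-cong N (Ns i) r r′ hits ⟩
    altNormal (Ns i) r′ (Bijection.to (Ns i) f)        ≡⟨ x≗ _ ⟨
    as i x (Bijection.to (Ns i) f)                     ≡⟨ ⨂ᴬ-place as i x _ ⟨
    ⨂ᴬ as (inj i x) (place i (Bijection.to (Ns i) f))  ∎
    where
    open ≡-Reasoning
    hits : ∀ l → (Bijection.to N (r l) ≡ c) ⇔ (Bijection.to (Ns i) (r′ l) ≡ Bijection.to (Ns i) f)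
    hits l = ⇔.trans (to≡⇔≡from (⤖⇒↔ N))
      (mk⇔ (λ eq → cong (Bijection.to (Ns i)) (emap-injective i (trans (r≡ l) (trans eq (sym emap-f≡)))))
           (λ eq → trans (sym (r≡ l)) (trans (cong (emap i) (Bijection.injective (Ns i) eq)) emap-f≡)))
  ...   | no i≢j = trans (altNormal-zero N r misses) (sym (⨂ᴬ-place-≢ as i≢j x _))
    where
    misses : ∀ l → Bijection.to N (r l) ≢ c
    misses l hit = i≢j (,-injectiveˡ (e-disj i (r′ l) j f
      (trans (r≡ l) (trans (Equivalence.to (to≡⇔≡from (⤖⇒↔ N)) hit) (sym emap-f≡)))))

  matching→ : ∀ p → ∃[ p′ ] Matches (MA G N) (⨂ᴬ as) Π p p′
  matching→ (inj₁ path) =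
    inj i (inj₁ path′) , along i (inj₁ path′) (SimplePath.edge path) edge′ emap-edge′ (λ _ → refl)
    where open LiftPath path
  matching→ (inj₂ cycle) =
    inj i (inj₂ cycle′) , along i (inj₂ cycle′) (EvenSimpleCycle.edge cycle) edge′ emap-edge′ (λ _ → refl)
    where open LiftCycle cycle

  matching← : ∀ p′ → ∃[ p ] Matches (MA G N) (⨂ᴬ as) Π p p′
  matching← p′ with inj-surjective p′
  ... | i , inj₁ path , refl =
    inj₁ (pushPath i path) , along i (inj₁ path) _ (SimplePath.edge path) (λ _ → refl) (λ _ → refl)
  ... | i , inj₂ cycle , refl =
    inj₂ (pushCycle i cycle) , along i (inj₂ cycle) _ (EvenSimpleCycle.edge cycle) (λ _ → refl) (λ _ → refl)

  chi-MA : (W : ChiWitness (MA G N)) (Ws : (i : Fin k) → ChiWitness (as i)) → ∀ t → chi W t ≡ ∏ℤ (λ i → chi (Ws i) t)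
  chi-MA W Ws t = trans (PermutedArrangement.chi-≡ (MA G N) (⨂ᴬ as) Π matching→ matching← W (⨂ᵂ Ws) t) (chi-⨂ Ws t)

corollary1 : (G : Graph) → NoLoops G → NoParallelEdges G → NoIsolatedVertices G →
             (k : ℕ) (Gs : Fin k → Graph) → Components G k Gs →
             (N : Numeration G) (Ns : (i : Fin k) → Numeration (Gs i)) →
             (W : ChiWitness (MA G N)) (Ws : (i : Fin k) → ChiWitness (MA (Gs i) (Ns i))) →
             (t : ℤ) → chi W t ≡ ∏ℤ (λ i → chi (Ws i) t)
corollary1 G _ _ _ k Gs C N Ns W Ws t = ComponentArrangements.chi-MA C N Ns W Ws t
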